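{- For integers $n>2k\ge 0$, we have $a(n,k)=a(n-1,k)+a(n-2,k-1)$, where $a(n-2,-1)$ is interpreted as $0$ when $k=0$.
   Context: $\Bbbk$ is a field of characteristic $0$; $\mathcal{M}$ is the free monoid on letters $D,U$; $\mathcal{W}=\Bbbk\langle D,U\mid DU-UD=1\rangle$ is the Weyl algebra; $\phi:\mathcal{M}\to\mathcal{W}$ is the monoid morphism with $D\mapsto D,U\mapsto U$. Two words $u,v$ are Weyl-equivalent if $\phi(u)=\phi(v)$. For $0\le k\le n$, $a(n,k)$ is the number of Weyl-equivalence classes of words having $k$ letters $D$ and $n-k$ letters $U$. -}

module Defs where

open import Level using (Level; _⊔_; Lift)
open import Algebra.Bundles using (CommutativeRing)
open import Data.Nat using (ℕ; zero; suc; _∸_)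
open import Data.List using (List; []; _∷_; length)
open import Data.Fin using (Fin)
open import Data.Product using (Σ; ∃; _×_; _,_; proj₁)
open import Function.Definitions using (Surjective)
open import Relation.Binary.PropositionalEquality using (_≡_)
open import Relation.Nullary using (¬_)

record Field (c ℓ : Level) : Set (Level.suc (c ⊔ ℓ)) where
  field
    commutativeRing : CommutativeRing c ℓ
  open CommutativeRing commutativeRing public
  field
    1≉0     : ¬ (1# ≈ 0#)
    inverse : ∀ x → ¬ (x ≈ 0#) → Σ Carrier λ y → x * y ≈ 1#

_·1 : ∀ {c ℓ} (K : Field c ℓ) → ℕ → Field.Carrier K
(K ·1) zero    = Field.0# K
(K ·1) (suc n) = Field._+_ K (Field.1# K) ((K ·1) n)

CharZero : ∀ {c ℓ} → Field c ℓ → Set ℓ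
CharZero K = ∀ n → Field._≈_ K ((K ·1) n) (Field.0# K) → n ≡ 0

-- The Weyl algebra  W = K⟨D,U | DU - UD = 1⟩, presented as the free
-- (associative, unital) K-algebra on D, U modulo the Weyl relation:
-- terms of the free algebra, and the least congruence containing the
-- K-algebra axioms and DU - UD = 1 (a setoid; quotients are unavailable).

module Weyl {c ℓ} (K : Field c ℓ) where
  open Field K using (Carrier; _≈_; _+_; _*_; 0#; 1#)

  infixl 6 _⊕_
  infixl 7 _⊛_

  data Tm : Set c where
    sc  : Carrier → Tm
    D U : Tm
    _⊕_ : Tm → Tm → Tm
    ⊖_  : Tm → Tm
    _⊛_ : Tm → Tm → Tm

  infix 4 _~_
  data _~_ : Tm → Tm → Set (c ⊔ ℓ) where
    ~refl  : ∀ {x} → x ~ x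
    ~sym   : ∀ {x y} → x ~ y → y ~ x
    ~trans : ∀ {x y z} → x ~ y → y ~ z → x ~ z
    ⊕-cong : ∀ {x x' y y'} → x ~ x' → y ~ y' → x ⊕ y ~ x' ⊕ y'
    ⊖-cong : ∀ {x x'} → x ~ x' → ⊖ x ~ ⊖ x'
    ⊛-cong : ∀ {x x' y y'} → x ~ x' → y ~ y' → x ⊛ y ~ x' ⊛ y'
    ⊕-assoc : ∀ x y z → (x ⊕ y) ⊕ z ~ x ⊕ (y ⊕ z)
    ⊕-comm  : ∀ x y → x ⊕ y ~ y ⊕ x
    ⊕-idʳ   : ∀ x → x ⊕ sc 0# ~ x
    ⊕-invʳ  : ∀ x → x ⊕ (⊖ x) ~ sc 0#
    ⊛-assoc : ∀ x y z → (x ⊛ y) ⊛ z ~ x ⊛ (y ⊛ z)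
    ⊛-idˡ   : ∀ x → sc 1# ⊛ x ~ x
    ⊛-idʳ   : ∀ x → x ⊛ sc 1# ~ x
    distribˡ : ∀ x y z → x ⊛ (y ⊕ z) ~ x ⊛ y ⊕ x ⊛ z
    distribʳ : ∀ x y z → (y ⊕ z) ⊛ x ~ y ⊛ x ⊕ z ⊛ x
    sc-cong : ∀ {a b} → a ≈ b → sc a ~ sc b
    sc-+    : ∀ a b → sc (a + b) ~ sc a ⊕ sc b
    sc-*    : ∀ a b → sc (a * b) ~ sc a ⊛ sc b
    sc-central : ∀ a x → sc a ⊛ x ~ x ⊛ sc a
    weyl : D ⊛ U ⊕ ⊖ (U ⊛ D) ~ sc 1#

data Letter : Set where
  Dₗ Uₗ : Letter

Word : Set
Word = List Letter

#D : Word → ℕ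
#D []       = 0
#D (Dₗ ∷ w) = suc (#D w)
#D (Uₗ ∷ w) = #D w

module Classes {c ℓ} (K : Field c ℓ) where
  open Field K using (Carrier; _≈_; _+_; _*_; 0#; 1#)
  open Weyl K public

  φ : Word → Tm
  φ []       = sc 1#
  φ (Dₗ ∷ w) = D ⊛ φ w
  φ (Uₗ ∷ w) = U ⊛ φ w

  _≡W_ : Word → Word → Set (c ⊔ ℓ)
  u ≡W v = φ u ~ φ v

  Words : ℕ → ℕ → Set
  Words n k = Σ Word λ w → length w ≡ n × #D w ≡ k

  -- "a(n,k) = m": the Weyl-equivalence classes on Words n k are in
  -- bijection with Fin m, i.e. there is a surjection f onto Fin m whose
  -- fibres are exactly the classes.
  NumClasses : ℕ → ℕ → ℕ → Set (c ⊔ ℓ)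
  NumClasses n k m =
    Σ (Words n k → Fin m) λ f →
      Surjective _≡_ _≡_ f ×
      (∀ (x y : Words n k) →
        (proj₁ x ≡W proj₁ y → f x ≡ f y) × (f x ≡ f y → proj₁ x ≡W proj₁ y))

  -- the term a(n-2, k-1), read as 0 when k = 0
  NumClassesPred : ℕ → ℕ → ℕ → Set (c ⊔ ℓ)
  NumClassesPred n zero    m = Lift (c ⊔ ℓ) (m ≡ 0)
  NumClassesPred n (suc j) m = NumClasses (n ∸ 2) j m

-- With θ = UD one has Dθ = (θ + 1)D and Uθ = (θ - 1)U, so every word equals a normal form
-- ∏ⱼ (θ + j)^(eⱼ) · Uʰ (with U⁻ᵇ meaning Dᵇ), which `state` computes letter by letter.
-- For h = t ≥ 0 the element determines the normal form: on power series, with D = d/dx and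
-- U = x, it sends x^(i - t) to (∏ⱼ (i + j)^(eⱼ)) · xⁱ, and in characteristic 0 these values for
-- all large i determine the exponents (for a prime p above the largest shift c, the value at
-- i = p - c is divisible by p only through the factor of that shift).  Hence for n = t + 2k the
-- classes are the normal forms of height t and total exponent k; listing them by whether θ
-- itself occurs gives the recurrence.

module Submission where

open import Level using (Level; lift)
import Algebra.Properties.AbelianGroup as AbelianGroupProperties
import Algebra.Properties.CommutativeSemigroup as CommutativeSemigroupProperties
open import Data.Empty using (⊥; ⊥-elim)
import Data.Fin.Base as Fin
open import Data.Integer.Base as ℤ using (ℤ; -[1+_]) renaming (+_ to pos)
open import Data.List.Base using (List; []; _∷_; _++_; length; foldr; drop; take; map; replicate; reverse; concatMap; lookup)
open import Data.List.Extrema.Nat using (max; ⊥≤max; xs≤max; argmax-sel)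
open import Data.List.Membership.Propositional using (_∈_; _─_)
open import Data.List.Membership.Propositional.Properties
  using (∈-lookup; ∈-++⁻; ∈-++⁺ˡ; ∈-++⁺ʳ; ∈-map⁺; ∈-map⁻)
open import Data.List.Properties
  using (foldr-++; map-++; ∷-injectiveˡ; ∷-injectiveʳ; ++-assoc; ++-identityʳ; unfold-reverse; length-reverse;
         length-map; length-++; take++drop≡id)
open import Data.List.Relation.Unary.All as All using (All; []; _∷_)
import Data.List.Relation.Unary.All.Properties as All
open import Data.List.Relation.Unary.Any as Any using (Any; here; there)
open import Data.List.Relation.Unary.Any.Properties using (lookup-index)
open import Data.List.Relation.Unary.Unique.Propositional using (Unique)
import Data.List.Relation.Unary.Unique.Propositional.Properties as Unique
import Data.List.Relation.Unary.AllPairs as AllPairs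
open import Data.List.Relation.Binary.Disjoint.Propositional using (Disjoint)
open import Data.Nat.Base using (ℕ; zero; suc; pred; _+_; _*_; _∸_; _≤_; _<_; _!; s≤s; z≤n; NonZero; >-nonZero)
open import Data.Nat.Divisibility
  using (_∣_; ∣-trans; m∣m*n; ∣n⇒∣m*n; ∣m+n∣m⇒∣n; ∣1⇒≡1; ∣⇒≤; m≤n⇒m!∣n!)
open import Data.Nat.ListAction using (sum; product)
open import Data.Nat.ListAction.Properties using (product-++)
open import Data.Nat.Primality using (Prime; euclidsLemma; prime⇒nonZero; ¬prime[1])
open import Data.Nat.Primality.Factorisation using (factorise)
open import Data.Nat.Properties
open import Data.Nat.Solver using (module +-*-Solver)
open +-*-Solver using (solve; _:+_; _:=_; con)
open import Data.Product.Base using (Σ; _×_; _,_; proj₁; proj₂; map₁)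
open import Data.Sum.Base using (inj₁; inj₂; [_,_]′)
open import Relation.Binary.Bundles using (Setoid)
import Relation.Binary.Reasoning.Setoid as SetoidReasoning
open import Relation.Binary.PropositionalEquality
open import Relation.Nullary using (yes; no)
open import Defs

open CommutativeSemigroupProperties *-commutativeSemigroup using () renaming (x∙yz≈y∙xz to *-exchange)
open CommutativeSemigroupProperties +-commutativeSemigroup using () renaming (x∙yz≈y∙xz to +-exchange)

-- The normal form of a word

-- (h , B , A) stands for ∏ⱼ (θ - j)^(B j) · ∏ⱼ (θ + 1 + j)^(A j) · Uʰ (see NormalForm.nf).
State : Set
State = ℤ × List ℕ × List ℕ

head₀ : List ℕ → ℕ
head₀ []      = 0
head₀ (x ∷ _) = x

step : Letter → State → State
step Uₗ (pos a , B , A)          = pos (suc a) , head₀ A ∷ B , drop 1 A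
step Uₗ (-[1+ zero ] , B , A)    = pos 0 , suc (head₀ A) ∷ B , drop 1 A
step Uₗ (-[1+ suc b ] , B , A)   = -[1+ b ] , suc (head₀ A) ∷ B , drop 1 A
step Dₗ (pos zero , B , A)       = -[1+ 0 ] , drop 1 B , head₀ B ∷ A
step Dₗ (pos (suc a) , B , A)    = pos a , drop 1 B , suc (head₀ B) ∷ A
step Dₗ (-[1+ b ] , B , A)       = -[1+ suc b ] , drop 1 B , head₀ B ∷ A

run : Word → State → State
run w s = foldr step s w

state : Word → State
state w = run w (pos 0 , [] , [])

run-++ : ∀ u v s → run (u ++ v) s ≡ run u (run v s)
run-++ u v s = foldr-++ step s u v

Positive : List ℕ → Set
Positive = All (0 <_)

PositiveAfter : ℕ → List ℕ → Set
PositiveAfter zero    B       = Positive B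
PositiveAfter (suc t) []      = ⊥
PositiveAfter (suc t) (_ ∷ B) = PositiveAfter t B

PositiveAfter-tail : ∀ t {x B} → PositiveAfter t (x ∷ B) → PositiveAfter (pred t) B
PositiveAfter-tail zero    (_ ∷ B⁺) = B⁺
PositiveAfter-tail (suc t) B⁺       = B⁺

module NormalForm {c ℓ : Level} (K : Field c ℓ) where
  open Field K using (Carrier; _≈_; 0#; 1#) renaming (_+_ to _+ᴷ_; _*_ to _*ᴷ_; -_ to -ᴷ_)
  open Classes K
  open AbelianGroupProperties (Field.+-abelianGroup K) using (//-rightDividesˡ; //-rightDividesʳ)
  open CommutativeSemigroupProperties (Field.+-commutativeSemigroup K) using (xy∙z≈xz∙y)

  Tm-setoid : Setoid c (c Level.⊔ ℓ)
  Tm-setoid = record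
    { Carrier = Tm ; _≈_ = _~_
    ; isEquivalence = record { refl = ~refl ; sym = ~sym ; trans = ~trans } }

  open SetoidReasoning Tm-setoid

  ≡⇒~ : ∀ {x y} → x ≡ y → x ~ y
  ≡⇒~ refl = ~refl

  ⊛-congˡ : ∀ {x x′} y → x ~ x′ → x ⊛ y ~ x′ ⊛ y
  ⊛-congˡ y p = ⊛-cong p ~refl

  ⊛-congʳ : ∀ x {y y′} → y ~ y′ → x ⊛ y ~ x ⊛ y′
  ⊛-congʳ x p = ⊛-cong ~refl p

  infixr 8 _⊛^_
  _⊛^_ : Tm → ℕ → Tm
  x ⊛^ zero  = sc 1#
  x ⊛^ suc n = x ⊛ x ⊛^ n

  ⊛^-cong : ∀ {x y} n → x ~ y → x ⊛^ n ~ y ⊛^ n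
  ⊛^-cong zero    p = ~refl
  ⊛^-cong (suc n) p = ⊛-cong p (⊛^-cong n p)

  θ : Tm
  θ = U ⊛ D

  θ+_ : Carrier → Tm
  θ+ a = θ ⊕ sc a

  θ+-cong : ∀ {a b} → a ≈ b → θ+ a ~ θ+ b
  θ+-cong p = ⊕-cong ~refl (sc-cong p)

  fallingΠ : Carrier → List ℕ → Tm
  fallingΠ a []      = sc 1#
  fallingΠ a (x ∷ B) = (θ+ a) ⊛^ x ⊛ fallingΠ (a +ᴷ -ᴷ 1#) B

  risingΠ : Carrier → List ℕ → Tm
  risingΠ a []      = sc 1#
  risingΠ a (x ∷ A) = (θ+ a) ⊛^ x ⊛ risingΠ (a +ᴷ 1#) A

  heightPower : ℤ → Tm
  heightPower (pos a)   = U ⊛^ a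
  heightPower -[1+ b ]  = D ⊛^ suc b

  θΠ : List ℕ → List ℕ → Tm
  θΠ B A = fallingΠ 0# B ⊛ risingΠ 1# A

  nf : State → Tm
  nf (h , B , A) = θΠ B A ⊛ heightPower h

  fallingΠ-cong : ∀ {a b} B → a ≈ b → fallingΠ a B ~ fallingΠ b B
  fallingΠ-cong []      p = ~refl
  fallingΠ-cong (x ∷ B) p = ⊛-cong (⊛^-cong x (θ+-cong p)) (fallingΠ-cong B (Field.+-congʳ K p))

  risingΠ-cong : ∀ {a b} A → a ≈ b → risingΠ a A ~ risingΠ b A
  risingΠ-cong []      p = ~refl
  risingΠ-cong (x ∷ A) p = ⊛-cong (⊛^-cong x (θ+-cong p)) (risingΠ-cong A (Field.+-congʳ K p))

  fallingΠ-head₀ : ∀ a B → fallingΠ a B ~ (θ+ a) ⊛^ head₀ B ⊛ fallingΠ (a +ᴷ -ᴷ 1#) (drop 1 B)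
  fallingΠ-head₀ a []      = ~sym (⊛-idˡ (sc 1#))
  fallingΠ-head₀ a (x ∷ B) = ~refl

  risingΠ-head₀ : ∀ a A → risingΠ a A ~ (θ+ a) ⊛^ head₀ A ⊛ risingΠ (a +ᴷ 1#) (drop 1 A)
  risingΠ-head₀ a []      = ~sym (⊛-idˡ (sc 1#))
  risingΠ-head₀ a (x ∷ A) = ~refl

  Commute : Tm → Tm → Set (c Level.⊔ ℓ)
  Commute x y = x ⊛ y ~ y ⊛ x

  commute-1 : ∀ x → Commute (sc 1#) x
  commute-1 x = ~trans (⊛-idˡ x) (~sym (⊛-idʳ x))

  commute-⊛ : ∀ {x y z} → Commute x y → Commute x z → Commute x (y ⊛ z)
  commute-⊛ {x} {y} {z} xy xz = begin
    x ⊛ (y ⊛ z)   ≈⟨ ⊛-assoc x y z ⟨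
    (x ⊛ y) ⊛ z   ≈⟨ ⊛-congˡ z xy ⟩
    (y ⊛ x) ⊛ z   ≈⟨ ⊛-assoc y x z ⟩
    y ⊛ (x ⊛ z)   ≈⟨ ⊛-congʳ y xz ⟩
    y ⊛ (z ⊛ x)   ≈⟨ ⊛-assoc y z x ⟨
    (y ⊛ z) ⊛ x   ∎

  θ+-commute : ∀ a b → Commute (θ+ a) (θ+ b)
  θ+-commute a b = begin
    (θ ⊕ sc a) ⊛ (θ ⊕ sc b)
      ≈⟨ expand a b ⟩
    (θ ⊛ θ ⊕ (θ ⊛ sc b ⊕ θ ⊛ sc a)) ⊕ sc (a *ᴷ b)
      ≈⟨ ⊕-cong (⊕-cong ~refl (⊕-comm _ _)) (sc-cong (Field.*-comm K a b)) ⟩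
    (θ ⊛ θ ⊕ (θ ⊛ sc a ⊕ θ ⊛ sc b)) ⊕ sc (b *ᴷ a)
      ≈⟨ expand b a ⟨
    (θ ⊕ sc b) ⊛ (θ ⊕ sc a) ∎
    where
    expand : ∀ a b → (θ ⊕ sc a) ⊛ (θ ⊕ sc b) ~ (θ ⊛ θ ⊕ (θ ⊛ sc b ⊕ θ ⊛ sc a)) ⊕ sc (a *ᴷ b)
    expand a b = begin
      (θ ⊕ sc a) ⊛ (θ ⊕ sc b)
        ≈⟨ distribʳ _ θ (sc a) ⟩
      θ ⊛ (θ ⊕ sc b) ⊕ sc a ⊛ (θ ⊕ sc b)
        ≈⟨ ⊕-cong (distribˡ θ θ (sc b)) (distribˡ (sc a) θ (sc b)) ⟩
      (θ ⊛ θ ⊕ θ ⊛ sc b) ⊕ (sc a ⊛ θ ⊕ sc a ⊛ sc b)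
        ≈⟨ ⊕-cong ~refl (⊕-cong (sc-central a θ) (~sym (sc-* a b))) ⟩
      (θ ⊛ θ ⊕ θ ⊛ sc b) ⊕ (θ ⊛ sc a ⊕ sc (a *ᴷ b))
        ≈⟨ ⊕-assoc _ _ _ ⟩
      θ ⊛ θ ⊕ (θ ⊛ sc b ⊕ (θ ⊛ sc a ⊕ sc (a *ᴷ b)))
        ≈⟨ ⊕-cong ~refl (⊕-assoc _ _ _) ⟨
      θ ⊛ θ ⊕ ((θ ⊛ sc b ⊕ θ ⊛ sc a) ⊕ sc (a *ᴷ b))
        ≈⟨ ⊕-assoc _ _ _ ⟨
      (θ ⊛ θ ⊕ (θ ⊛ sc b ⊕ θ ⊛ sc a)) ⊕ sc (a *ᴷ b) ∎

  data ΘProduct : Tm → Set c where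
    one    : ΘProduct (sc 1#)
    factor : ∀ a → ΘProduct (θ+ a)
    _⊛ₚ_   : ∀ {x y} → ΘProduct x → ΘProduct y → ΘProduct (x ⊛ y)

  ΘProduct-commute : ∀ {x y} → ΘProduct x → ΘProduct y → Commute x y
  ΘProduct-commute one        q = commute-1 _
  ΘProduct-commute (p ⊛ₚ p′)  q = ~sym (commute-⊛ (~sym (ΘProduct-commute p q)) (~sym (ΘProduct-commute p′ q)))
  ΘProduct-commute (factor a) one        = ~sym (commute-1 _)
  ΘProduct-commute (factor a) (factor b) = θ+-commute a b
  ΘProduct-commute (factor a) (q ⊛ₚ q′)  = commute-⊛ (ΘProduct-commute (factor a) q) (ΘProduct-commute (factor a) q′)

  ⊛^-ΘProduct : ∀ a n → ΘProduct ((θ+ a) ⊛^ n)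
  ⊛^-ΘProduct a zero    = one
  ⊛^-ΘProduct a (suc n) = factor a ⊛ₚ ⊛^-ΘProduct a n

  fallingΠ-ΘProduct : ∀ a B → ΘProduct (fallingΠ a B)
  fallingΠ-ΘProduct a []      = one
  fallingΠ-ΘProduct a (x ∷ B) = ⊛^-ΘProduct a x ⊛ₚ fallingΠ-ΘProduct _ B

  risingΠ-ΘProduct : ∀ a A → ΘProduct (risingΠ a A)
  risingΠ-ΘProduct a []      = one
  risingΠ-ΘProduct a (x ∷ A) = ⊛^-ΘProduct a x ⊛ₚ risingΠ-ΘProduct _ A

  DU~θ+1 : D ⊛ U ~ θ+ 1#
  DU~θ+1 = begin
    D ⊛ U                    ≈⟨ ⊕-idʳ (D ⊛ U) ⟨
    D ⊛ U ⊕ sc 0#            ≈⟨ ⊕-cong ~refl (~trans (⊕-comm _ _) (⊕-invʳ θ)) ⟨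
    D ⊛ U ⊕ (⊖ θ ⊕ θ)        ≈⟨ ⊕-assoc _ _ _ ⟨
    (D ⊛ U ⊕ ⊖ θ) ⊕ θ        ≈⟨ ⊕-cong weyl ~refl ⟩
    sc 1# ⊕ θ                ≈⟨ ⊕-comm _ _ ⟩
    θ+ 1#                    ∎

  UD~θ+0 : U ⊛ D ~ θ+ 0#
  UD~θ+0 = ~sym (⊕-idʳ θ)

  Dθ : D ⊛ θ ~ θ ⊛ D ⊕ D
  Dθ = begin
    D ⊛ (U ⊛ D)           ≈⟨ ⊛-assoc D U D ⟨
    (D ⊛ U) ⊛ D           ≈⟨ ⊛-congˡ D DU~θ+1 ⟩
    (θ ⊕ sc 1#) ⊛ D       ≈⟨ distribʳ D θ (sc 1#) ⟩
    θ ⊛ D ⊕ sc 1# ⊛ D     ≈⟨ ⊕-cong ~refl (⊛-idˡ D) ⟩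
    θ ⊛ D ⊕ D             ∎

  θU : θ ⊛ U ~ U ⊛ θ ⊕ U
  θU = begin
    (U ⊛ D) ⊛ U           ≈⟨ ⊛-assoc U D U ⟩
    U ⊛ (D ⊛ U)           ≈⟨ ⊛-congʳ U DU~θ+1 ⟩
    U ⊛ (θ ⊕ sc 1#)       ≈⟨ distribˡ U θ (sc 1#) ⟩
    U ⊛ θ ⊕ U ⊛ sc 1#     ≈⟨ ⊕-cong ~refl (⊛-idʳ U) ⟩
    U ⊛ θ ⊕ U             ∎

  Dθ+ : ∀ a → D ⊛ θ+ a ~ θ+ (a +ᴷ 1#) ⊛ D
  Dθ+ a = begin
    D ⊛ (θ ⊕ sc a)                   ≈⟨ distribˡ D θ (sc a) ⟩
    D ⊛ θ ⊕ D ⊛ sc a                 ≈⟨ ⊕-cong Dθ (~sym (sc-central a D)) ⟩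
    (θ ⊛ D ⊕ D) ⊕ sc a ⊛ D           ≈⟨ ⊕-assoc _ _ _ ⟩
    θ ⊛ D ⊕ (D ⊕ sc a ⊛ D)           ≈⟨ ⊕-cong ~refl (⊕-comm _ _) ⟩
    θ ⊛ D ⊕ (sc a ⊛ D ⊕ D)           ≈⟨ ⊕-cong ~refl (⊕-cong ~refl (⊛-idˡ D)) ⟨
    θ ⊛ D ⊕ (sc a ⊛ D ⊕ sc 1# ⊛ D)   ≈⟨ ⊕-cong ~refl (distribʳ D (sc a) (sc 1#)) ⟨
    θ ⊛ D ⊕ (sc a ⊕ sc 1#) ⊛ D       ≈⟨ ⊕-cong ~refl (⊛-congˡ D (sc-+ a 1#)) ⟨
    θ ⊛ D ⊕ sc (a +ᴷ 1#) ⊛ D         ≈⟨ distribʳ D θ (sc (a +ᴷ 1#)) ⟨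
    θ+ (a +ᴷ 1#) ⊛ D                 ∎

  θ+U : ∀ a → θ+ a ⊛ U ~ U ⊛ θ+ (a +ᴷ 1#)
  θ+U a = begin
    (θ ⊕ sc a) ⊛ U                   ≈⟨ distribʳ U θ (sc a) ⟩
    θ ⊛ U ⊕ sc a ⊛ U                 ≈⟨ ⊕-cong θU (sc-central a U) ⟩
    (U ⊛ θ ⊕ U) ⊕ U ⊛ sc a           ≈⟨ ⊕-assoc _ _ _ ⟩
    U ⊛ θ ⊕ (U ⊕ U ⊛ sc a)           ≈⟨ ⊕-cong ~refl (⊕-comm _ _) ⟩
    U ⊛ θ ⊕ (U ⊛ sc a ⊕ U)           ≈⟨ ⊕-cong ~refl (⊕-cong ~refl (⊛-idʳ U)) ⟨
    U ⊛ θ ⊕ (U ⊛ sc a ⊕ U ⊛ sc 1#)   ≈⟨ ⊕-cong ~refl (distribˡ U (sc a) (sc 1#)) ⟨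
    U ⊛ θ ⊕ U ⊛ (sc a ⊕ sc 1#)       ≈⟨ ⊕-cong ~refl (⊛-congʳ U (sc-+ a 1#)) ⟨
    U ⊛ θ ⊕ U ⊛ sc (a +ᴷ 1#)         ≈⟨ distribˡ U θ (sc (a +ᴷ 1#)) ⟨
    U ⊛ θ+ (a +ᴷ 1#)                 ∎

  Uθ+ : ∀ a → U ⊛ θ+ a ~ θ+ (a +ᴷ -ᴷ 1#) ⊛ U
  Uθ+ a = ~sym (~trans (θ+U (a +ᴷ -ᴷ 1#)) (⊛-congʳ U (θ+-cong (//-rightDividesˡ 1# a))))

  module Slide (X : Tm) (δ : Carrier) (Xθ+ : ∀ a → X ⊛ θ+ a ~ θ+ (a +ᴷ δ) ⊛ X) where

    slide-⊛ : ∀ {P Q P′ Q′} → X ⊛ P ~ P′ ⊛ X → X ⊛ Q ~ Q′ ⊛ X → X ⊛ (P ⊛ Q) ~ (P′ ⊛ Q′) ⊛ X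
    slide-⊛ {P} {Q} {P′} {Q′} p q = begin
      X ⊛ (P ⊛ Q)      ≈⟨ ⊛-assoc X P Q ⟨
      (X ⊛ P) ⊛ Q      ≈⟨ ⊛-congˡ Q p ⟩
      (P′ ⊛ X) ⊛ Q     ≈⟨ ⊛-assoc P′ X Q ⟩
      P′ ⊛ (X ⊛ Q)     ≈⟨ ⊛-congʳ P′ q ⟩
      P′ ⊛ (Q′ ⊛ X)    ≈⟨ ⊛-assoc P′ Q′ X ⟨
      (P′ ⊛ Q′) ⊛ X    ∎

    slide-1 : X ⊛ sc 1# ~ sc 1# ⊛ X
    slide-1 = ~sym (commute-1 X)

    slide-⊛^ : ∀ a n → X ⊛ (θ+ a) ⊛^ n ~ (θ+ (a +ᴷ δ)) ⊛^ n ⊛ X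
    slide-⊛^ a zero    = slide-1
    slide-⊛^ a (suc n) = slide-⊛ (Xθ+ a) (slide-⊛^ a n)

    slide-fallingΠ : ∀ a B → X ⊛ fallingΠ a B ~ fallingΠ (a +ᴷ δ) B ⊛ X
    slide-fallingΠ a []      = slide-1
    slide-fallingΠ a (x ∷ B) = slide-⊛ (slide-⊛^ a x)
      (~trans (slide-fallingΠ (a +ᴷ -ᴷ 1#) B) (⊛-congˡ X (fallingΠ-cong B (xy∙z≈xz∙y a (-ᴷ 1#) δ))))

    slide-risingΠ : ∀ a A → X ⊛ risingΠ a A ~ risingΠ (a +ᴷ δ) A ⊛ X
    slide-risingΠ a []      = slide-1
    slide-risingΠ a (x ∷ A) = slide-⊛ (slide-⊛^ a x)
      (~trans (slide-risingΠ (a +ᴷ 1#) A) (⊛-congˡ X (risingΠ-cong A (xy∙z≈xz∙y a 1# δ))))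

    slide-θΠ : ∀ B A Y → X ⊛ (θΠ B A ⊛ Y) ~ (fallingΠ (0# +ᴷ δ) B ⊛ risingΠ (1# +ᴷ δ) A) ⊛ (X ⊛ Y)
    slide-θΠ B A Y = begin
      X ⊛ (θΠ B A ⊛ Y)     ≈⟨ ⊛-assoc _ _ _ ⟨
      (X ⊛ θΠ B A) ⊛ Y     ≈⟨ ⊛-congˡ Y (slide-⊛ (slide-fallingΠ 0# B) (slide-risingΠ 1# A)) ⟩
      (_ ⊛ X) ⊛ Y          ≈⟨ ⊛-assoc _ _ _ ⟩
      _ ⊛ (X ⊛ Y)          ∎

  U⊛θΠ : ∀ B A Y → U ⊛ (θΠ B A ⊛ Y) ~ θΠ (head₀ A ∷ B) (drop 1 A) ⊛ (U ⊛ Y)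
  U⊛θΠ B A Y = ~trans (Slide.slide-θΠ U (-ᴷ 1#) Uθ+ B A Y) (⊛-congˡ (U ⊛ Y) (begin
    F ⊛ risingΠ (1# +ᴷ -ᴷ 1#) A
      ≈⟨ ⊛-congʳ F (risingΠ-head₀ _ A) ⟩
    F ⊛ ((θ+ (1# +ᴷ -ᴷ 1#)) ⊛^ head₀ A ⊛ risingΠ ((1# +ᴷ -ᴷ 1#) +ᴷ 1#) (drop 1 A))
      ≈⟨ ⊛-congʳ F (⊛-cong (⊛^-cong (head₀ A) (θ+-cong (Field.-‿inverseʳ K 1#)))
                           (risingΠ-cong (drop 1 A) (//-rightDividesˡ 1# 1#))) ⟩
    F ⊛ (P ⊛ risingΠ 1# (drop 1 A))
      ≈⟨ ⊛-assoc F P _ ⟨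
    (F ⊛ P) ⊛ risingΠ 1# (drop 1 A)
      ≈⟨ ⊛-congˡ _ (ΘProduct-commute (fallingΠ-ΘProduct _ B) (⊛^-ΘProduct 0# (head₀ A))) ⟩
    θΠ (head₀ A ∷ B) (drop 1 A) ∎))
    where
    F = fallingΠ (0# +ᴷ -ᴷ 1#) B
    P = (θ+ 0#) ⊛^ head₀ A

  D⊛θΠ : ∀ B A Y → D ⊛ (θΠ B A ⊛ Y) ~ θΠ (drop 1 B) (head₀ B ∷ A) ⊛ (D ⊛ Y)
  D⊛θΠ B A Y = ~trans (Slide.slide-θΠ D 1# Dθ+ B A Y) (⊛-congˡ (D ⊛ Y) (begin
    fallingΠ (0# +ᴷ 1#) B ⊛ R
      ≈⟨ ⊛-congˡ R (fallingΠ-head₀ _ B) ⟩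
    ((θ+ (0# +ᴷ 1#)) ⊛^ head₀ B ⊛ fallingΠ ((0# +ᴷ 1#) +ᴷ -ᴷ 1#) (drop 1 B)) ⊛ R
      ≈⟨ ⊛-congˡ R (⊛-cong (⊛^-cong (head₀ B) (θ+-cong (Field.+-identityˡ K 1#)))
                           (fallingΠ-cong (drop 1 B) (//-rightDividesʳ 1# 0#))) ⟩
    (P ⊛ fallingΠ 0# (drop 1 B)) ⊛ R
      ≈⟨ ⊛-congˡ R (ΘProduct-commute (⊛^-ΘProduct 1# (head₀ B)) (fallingΠ-ΘProduct 0# (drop 1 B))) ⟩
    (fallingΠ 0# (drop 1 B) ⊛ P) ⊛ R
      ≈⟨ ⊛-assoc _ P R ⟩
    θΠ (drop 1 B) (head₀ B ∷ A) ∎))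
    where
    R = risingΠ (1# +ᴷ 1#) A
    P = (θ+ 1#) ⊛^ head₀ B

  absorb-falling : ∀ x B A Y → θΠ (x ∷ B) A ⊛ (θ+ 0# ⊛ Y) ~ θΠ (suc x ∷ B) A ⊛ Y
  absorb-falling x B A Y = begin
    ((P ⊛ Q) ⊛ R) ⊛ (θ+ 0# ⊛ Y)     ≈⟨ ⊛-assoc _ _ _ ⟨
    (((P ⊛ Q) ⊛ R) ⊛ θ+ 0#) ⊛ Y     ≈⟨ ⊛-congˡ Y (ΘProduct-commute PQR (factor 0#)) ⟩
    (θ+ 0# ⊛ ((P ⊛ Q) ⊛ R)) ⊛ Y     ≈⟨ ⊛-congˡ Y (⊛-assoc _ _ _) ⟨
    ((θ+ 0# ⊛ (P ⊛ Q)) ⊛ R) ⊛ Y     ≈⟨ ⊛-congˡ Y (⊛-congˡ R (⊛-assoc _ _ _)) ⟨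
    θΠ (suc x ∷ B) A ⊛ Y            ∎
    where
    P = (θ+ 0#) ⊛^ x
    Q = fallingΠ (0# +ᴷ -ᴷ 1#) B
    R = risingΠ 1# A
    PQR = (⊛^-ΘProduct 0# x ⊛ₚ fallingΠ-ΘProduct _ B) ⊛ₚ risingΠ-ΘProduct 1# A

  absorb-rising : ∀ B x A Y → θΠ B (x ∷ A) ⊛ (θ+ 1# ⊛ Y) ~ θΠ B (suc x ∷ A) ⊛ Y
  absorb-rising B x A Y = begin
    (F ⊛ (P ⊛ R)) ⊛ (θ+ 1# ⊛ Y)     ≈⟨ ⊛-assoc _ _ _ ⟨
    ((F ⊛ (P ⊛ R)) ⊛ θ+ 1#) ⊛ Y     ≈⟨ ⊛-congˡ Y (⊛-assoc _ _ _) ⟩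
    (F ⊛ ((P ⊛ R) ⊛ θ+ 1#)) ⊛ Y     ≈⟨ ⊛-congˡ Y (⊛-congʳ F (ΘProduct-commute PR (factor 1#))) ⟩
    (F ⊛ (θ+ 1# ⊛ (P ⊛ R))) ⊛ Y     ≈⟨ ⊛-congˡ Y (⊛-congʳ F (⊛-assoc _ _ _)) ⟨
    θΠ B (suc x ∷ A) ⊛ Y            ∎
    where
    F = fallingΠ 0# B
    P = (θ+ 1#) ⊛^ x
    R = risingΠ (1# +ᴷ 1#) A
    PR = ⊛^-ΘProduct 1# x ⊛ₚ risingΠ-ΘProduct _ A

  U⊛nf : ∀ s → U ⊛ nf s ~ nf (step Uₗ s)
  U⊛nf (pos a , B , A)    = U⊛θΠ B A _
  U⊛nf (-[1+ b ] , B , A) = begin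
    U ⊛ (θΠ B A ⊛ (D ⊛ D ⊛^ b))                        ≈⟨ U⊛θΠ B A _ ⟩
    θΠ (head₀ A ∷ B) (drop 1 A) ⊛ (U ⊛ (D ⊛ D ⊛^ b))   ≈⟨ ⊛-congʳ _ (⊛-assoc U D _) ⟨
    θΠ (head₀ A ∷ B) (drop 1 A) ⊛ ((U ⊛ D) ⊛ D ⊛^ b)   ≈⟨ ⊛-congʳ _ (⊛-congˡ _ UD~θ+0) ⟩
    θΠ (head₀ A ∷ B) (drop 1 A) ⊛ (θ+ 0# ⊛ D ⊛^ b)     ≈⟨ absorb-falling _ B _ _ ⟩
    θΠ (suc (head₀ A) ∷ B) (drop 1 A) ⊛ D ⊛^ b         ≈⟨ ≡⇒~ (nf-step b) ⟩
    nf (step Uₗ (-[1+ b ] , B , A))                    ∎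
    where
    nf-step : ∀ b → θΠ (suc (head₀ A) ∷ B) (drop 1 A) ⊛ D ⊛^ b ≡ nf (step Uₗ (-[1+ b ] , B , A))
    nf-step zero    = refl
    nf-step (suc b) = refl

  D⊛nf : ∀ s → D ⊛ nf s ~ nf (step Dₗ s)
  D⊛nf (pos zero , B , A)    = D⊛θΠ B A _
  D⊛nf (-[1+ b ] , B , A)    = D⊛θΠ B A _
  D⊛nf (pos (suc a) , B , A) = begin
    D ⊛ (θΠ B A ⊛ (U ⊛ U ⊛^ a))                        ≈⟨ D⊛θΠ B A _ ⟩
    θΠ (drop 1 B) (head₀ B ∷ A) ⊛ (D ⊛ (U ⊛ U ⊛^ a))   ≈⟨ ⊛-congʳ _ (⊛-assoc D U _) ⟨
    θΠ (drop 1 B) (head₀ B ∷ A) ⊛ ((D ⊛ U) ⊛ U ⊛^ a)   ≈⟨ ⊛-congʳ _ (⊛-congˡ _ DU~θ+1) ⟩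
    θΠ (drop 1 B) (head₀ B ∷ A) ⊛ (θ+ 1# ⊛ U ⊛^ a)     ≈⟨ absorb-rising _ _ A _ ⟩
    nf (step Dₗ (pos (suc a) , B , A))                 ∎

  φ~nf : ∀ w → φ w ~ nf (state w)
  φ~nf []       = ~trans (~sym (⊛-idˡ (sc 1#))) (⊛-congˡ (sc 1#) (~sym (⊛-idˡ (sc 1#))))
  φ~nf (Dₗ ∷ w) = ~trans (⊛-congʳ D (φ~nf w)) (D⊛nf (state w))
  φ~nf (Uₗ ∷ w) = ~trans (⊛-congʳ U (φ~nf w)) (U⊛nf (state w))

  state≡⇒≡W : ∀ u v → state u ≡ state v → u ≡W v
  state≡⇒≡W u v eq = ~trans (φ~nf u) (~trans (≡⇒~ (cong nf eq)) (~sym (φ~nf v)))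

-- Multisets determined by shifted products

shiftedProduct : ℕ → List ℕ → ℕ
shiftedProduct M xs = product (map (M +_) xs)

shiftedProduct-++ : ∀ M xs ys → shiftedProduct M (xs ++ ys) ≡ shiftedProduct M xs * shiftedProduct M ys
shiftedProduct-++ M xs ys = trans (cong product (map-++ (M +_) xs ys)) (product-++ (map (M +_) xs) _)

indicator : ℕ → ℕ → ℕ
indicator v x with v ≟ x
... | yes _ = 1
... | no _  = 0

count : ℕ → List ℕ → ℕ
count v []       = 0
count v (x ∷ xs) = indicator v x + count v xs

count-++ : ∀ v xs ys → count v (xs ++ ys) ≡ count v xs + count v ys
count-++ v []       ys = refl
count-++ v (x ∷ xs) ys = trans (cong (indicator v x +_) (count-++ v xs ys)) (sym (+-assoc (indicator v x) _ _))

count-replicate : ∀ v n → count v (replicate n v) ≡ n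
count-replicate v zero    = refl
count-replicate v (suc n) with v ≟ v
... | yes _  = cong suc (count-replicate v n)
... | no v≢v = ⊥-elim (v≢v refl)

count-absent : ∀ v xs → All (v ≢_) xs → count v xs ≡ 0
count-absent v []       []           = refl
count-absent v (x ∷ xs) (v≢x ∷ v∉xs) with v ≟ x
... | yes v≡x = ⊥-elim (v≢x v≡x)
... | no _    = count-absent v xs v∉xs

count-replicate-++ : ∀ v n xs → All (v ≢_) xs → count v (replicate n v ++ xs) ≡ n
count-replicate-++ v n xs v∉xs =
  trans (count-++ v (replicate n v) xs) (trans (cong₂ _+_ (count-replicate v n) (count-absent v xs v∉xs)) (+-identityʳ n))

count-replicate-other : ∀ {v w} n xs → v ≢ w → count v (replicate n w ++ xs) ≡ count v xs
count-replicate-other {v} n xs v≢w =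
  trans (count-++ v (replicate n _) xs) (cong (_+ count v xs) (count-absent v _ (All.replicate⁺ n v≢w)))

∣n! : ∀ {m n} → .{{NonZero m}} → m ≤ n → m ∣ n !
∣n! {suc m} m≤n = ∣-trans (m∣m*n (m !)) (m≤n⇒m!∣n! m≤n)

-- Euclid: a prime factor of n! + 1 exceeds n.
∃-prime> : ∀ n → Σ ℕ λ p → Prime p × n < p
∃-prime> n with factorise (n ! + 1) {{>-nonZero (m≤n+m 1 (n !))}}
... | record { factors = [] ; isFactorisation = n!+1≡1 } =
  ⊥-elim (<⇒≢ (1≤n! n) (sym (cong pred (trans (+-comm 1 (n !)) n!+1≡1))))
... | record { factors = p ∷ ps ; isFactorisation = n!+1≡p*_ ; factorsPrime = prime[p] ∷ _ } with n <? p
... | yes n<p = p , prime[p] , n<p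
... | no  n≮p = ⊥-elim (¬prime[1] (subst Prime (∣1⇒≡1 p∣1) prime[p]))
  where
  instance _ = prime⇒nonZero prime[p]
  p∣1 : p ∣ 1
  p∣1 = ∣m+n∣m⇒∣n (subst (p ∣_) (sym n!+1≡p*_) (m∣m*n (product ps))) (∣n! (≮⇒≥ n≮p))

∈⇒∣shiftedProduct : ∀ M {x xs} → x ∈ xs → M + x ∣ shiftedProduct M xs
∈⇒∣shiftedProduct M {xs = y ∷ ys} (here refl) = m∣m*n (shiftedProduct M ys)
∈⇒∣shiftedProduct M {xs = y ∷ ys} (there x∈ys) = ∣n⇒∣m*n (M + y) (∈⇒∣shiftedProduct M x∈ys)

prime∣shiftedProduct : ∀ {p} M ys → Prime p → p ∣ shiftedProduct M ys → Any (λ y → p ∣ M + y) ys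
prime∣shiftedProduct M []       prime[p] p∣1 = ⊥-elim (¬prime[1] (subst Prime (∣1⇒≡1 p∣1) prime[p]))
prime∣shiftedProduct M (y ∷ ys) prime[p] p∣ with euclidsLemma (M + y) (shiftedProduct M ys) prime[p] p∣
... | inj₁ p∣M+y  = here p∣M+y
... | inj₂ p∣rest = there (prime∣shiftedProduct M ys prime[p] p∣rest)

SameShiftedProducts : List ℕ → List ℕ → Set
SameShiftedProducts xs ys = ∀ M → 1 ≤ M → shiftedProduct M xs ≡ shiftedProduct M ys

-- For a prime p > m and M = p ∸ m, the factor M + m = p of the left product must
-- divide a factor M + y ≤ p on the right, forcing y = m.
maximum-shared : ∀ {m xs ys} → m ∈ xs → All (_≤ m) ys → SameShiftedProducts xs ys → m ∈ ys
maximum-shared {m} {xs} {ys} m∈xs ys≤m same = find (prime∣shiftedProduct M ys prime[p] p∣ys) ys≤m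
  where
  p = proj₁ (∃-prime> m)
  prime[p] = proj₁ (proj₂ (∃-prime> m))
  m<p = proj₂ (proj₂ (∃-prime> m))
  M = p ∸ m
  0<M : 0 < M
  0<M = m<n⇒0<n∸m m<p
  M+m≡p : M + m ≡ p
  M+m≡p = m∸n+n≡m (<⇒≤ m<p)
  p∣ys : p ∣ shiftedProduct M ys
  p∣ys = subst (p ∣_) (same M 0<M) (subst (_∣ shiftedProduct M xs) M+m≡p (∈⇒∣shiftedProduct M m∈xs))
  find : ∀ {zs} → Any (λ y → p ∣ M + y) zs → All (_≤ m) zs → m ∈ zs
  find (here {y} p∣M+y) (y≤m ∷ _) = here (sym (+-cancelˡ-≡ M y m (≤-antisym M+y≤p p≤M+y)))
    where
    instance _ = >-nonZero (≤-trans 0<M (m≤m+n M y))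
    M+y≤p : M + y ≤ M + m
    M+y≤p = +-monoʳ-≤ M y≤m
    p≤M+y : M + m ≤ M + y
    p≤M+y = subst (_≤ M + y) (sym M+m≡p) (∣⇒≤ p∣M+y)
  find (there any) (_ ∷ zs≤m) = there (find any zs≤m)

∃-maximum : ∀ {z zs} → z ∈ zs → Σ ℕ λ m → m ∈ zs × All (_≤ m) zs
∃-maximum {zs = w ∷ ws} _ = max w ws , [ here , there ]′ (argmax-sel (λ x → x) w ws) , ⊥≤max w ws ∷ xs≤max w ws

common-element : ∀ xs ys {z} → z ∈ xs ++ ys → SameShiftedProducts xs ys → Σ ℕ λ m → m ∈ xs × m ∈ ys
common-element xs ys z∈ same with ∃-maximum z∈
... | m , m∈ , ≤m with All.++⁻ xs ≤m | ∈-++⁻ xs m∈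
...   | xs≤m , ys≤m | inj₁ m∈xs = m , m∈xs , maximum-shared m∈xs ys≤m same
...   | xs≤m , ys≤m | inj₂ m∈ys = m , maximum-shared m∈ys xs≤m (λ M 0<M → sym (same M 0<M)) , m∈ys

shiftedProduct-─ : ∀ M {x xs} (x∈xs : x ∈ xs) → shiftedProduct M xs ≡ (M + x) * shiftedProduct M (xs ─ x∈xs)
shiftedProduct-─ M (here refl) = refl
shiftedProduct-─ M {x} {y ∷ ys} (there x∈ys) =
  trans (cong ((M + y) *_) (shiftedProduct-─ M x∈ys)) (*-exchange (M + y) (M + x) _)

count-─ : ∀ v {x xs} (x∈xs : x ∈ xs) → count v xs ≡ indicator v x + count v (xs ─ x∈xs)
count-─ v (here refl) = refl
count-─ v {x} {y ∷ ys} (there x∈ys) =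
  trans (cong (indicator v y +_) (count-─ v x∈ys)) (+-exchange (indicator v y) (indicator v x) _)

length-─ : ∀ {x : ℕ} {xs} (x∈xs : x ∈ xs) → length xs ≡ suc (length (xs ─ x∈xs))
length-─ (here refl) = refl
length-─ {xs = _ ∷ _} (there x∈ys) = cong suc (length-─ x∈ys)

shiftedProducts⇒count : ∀ n xs ys → length xs ≤ n → SameShiftedProducts xs ys → ∀ v → count v xs ≡ count v ys
shiftedProducts⇒count n [] [] _ _ v = refl
shiftedProducts⇒count n [] (y ∷ ys) _ same v with common-element [] (y ∷ ys) (here refl) same
... | _ , () , _
shiftedProducts⇒count (suc n) (x ∷ xs) ys (s≤s |xs|≤n) same v with common-element (x ∷ xs) ys (here refl) same
... | m , m∈x∷xs , m∈ys = begin
  count v (x ∷ xs)           ≡⟨ count-─ v m∈x∷xs ⟩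
  indicator v m + count v R  ≡⟨ cong (indicator v m +_) (shiftedProducts⇒count n R R′ |R|≤n same′ v) ⟩
  indicator v m + count v R′ ≡⟨ count-─ v m∈ys ⟨
  count v ys                 ∎
  where
  open ≡-Reasoning
  R  = (x ∷ xs) ─ m∈x∷xs
  R′ = ys ─ m∈ys
  |R|≤n : length R ≤ n
  |R|≤n = subst (_≤ n) (suc-injective (length-─ m∈x∷xs)) |xs|≤n
  same′ : SameShiftedProducts R R′
  same′ M 0<M = *-cancelˡ-≡ _ _ (M + m) {{>-nonZero (≤-trans 0<M (m≤m+n M m))}} (begin
    (M + m) * shiftedProduct M R   ≡⟨ shiftedProduct-─ M m∈x∷xs ⟨
    shiftedProduct M (x ∷ xs)      ≡⟨ same M 0<M ⟩
    shiftedProduct M ys            ≡⟨ shiftedProduct-─ M m∈ys ⟩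
    (M + m) * shiftedProduct M R′  ∎)

fallingOffsets : ℕ → List ℕ → List ℕ
fallingOffsets w []      = []
fallingOffsets w (x ∷ B) = replicate x w ++ fallingOffsets (pred w) B

risingOffsets : ℕ → List ℕ → List ℕ
risingOffsets w []      = []
risingOffsets w (x ∷ A) = replicate x w ++ risingOffsets (suc w) A

-- At x^(M + O) the factor θ - j of a normal form acts as M + (O - j), and θ + 1 + j as M + (O + 1 + j).
offsets : ℕ → List ℕ → List ℕ → List ℕ
offsets O B A = fallingOffsets O B ++ risingOffsets (suc O) A

fallingOffsets≤ : ∀ w B → All (_≤ w) (fallingOffsets w B)
fallingOffsets≤ w []      = []
fallingOffsets≤ w (x ∷ B) =
  All.++⁺ (All.replicate⁺ x ≤-refl) (All.map (λ v≤ → ≤-trans v≤ pred[n]≤n) (fallingOffsets≤ (pred w) B))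

risingOffsets≥ : ∀ w A → All (w ≤_) (risingOffsets w A)
risingOffsets≥ w []      = []
risingOffsets≥ w (x ∷ A) =
  All.++⁺ (All.replicate⁺ x ≤-refl) (All.map (λ ≤v → ≤-trans (n≤1+n w) ≤v) (risingOffsets≥ (suc w) A))

count-risingOffsets-head : ∀ w x A → count w (risingOffsets w (x ∷ A)) ≡ x
count-risingOffsets-head w x A = count-replicate-++ w x _ (All.map <⇒≢ (risingOffsets≥ (suc w) A))

count-risingOffsets-tail : ∀ {v w} x A → w < v → count v (risingOffsets w (x ∷ A)) ≡ count v (risingOffsets (suc w) A)
count-risingOffsets-tail x A w<v = count-replicate-other x _ (>⇒≢ w<v)

count-fallingOffsets-head : ∀ w x R → length R ≤ w → count w (fallingOffsets w (x ∷ R)) ≡ x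
count-fallingOffsets-head zero    x [] _ = count-replicate-++ 0 x [] []
count-fallingOffsets-head (suc w) x R _  =
  count-replicate-++ (suc w) x _ (All.map (λ v≤w → >⇒≢ (s≤s v≤w)) (fallingOffsets≤ w R))

count-fallingOffsets-tail : ∀ {v w} x R → v ≤ w →
  count v (fallingOffsets (suc w) (x ∷ R)) ≡ count v (fallingOffsets w R)
count-fallingOffsets-tail x R v≤w = count-replicate-other x _ (<⇒≢ (s≤s v≤w))

risingOffsets-injective : ∀ w A A′ → Positive A → Positive A′ →
  (∀ v → w ≤ v → count v (risingOffsets w A) ≡ count v (risingOffsets w A′)) → A ≡ A′
risingOffsets-injective w [] [] _ _ same = refl
risingOffsets-injective w [] (x′ ∷ A′) _ (0<x′ ∷ _) same =
  ⊥-elim (<⇒≢ 0<x′ (trans (same w ≤-refl) (count-risingOffsets-head w x′ A′)))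
risingOffsets-injective w (x ∷ A) [] (0<x ∷ _) _ same =
  ⊥-elim (<⇒≢ 0<x (trans (sym (same w ≤-refl)) (count-risingOffsets-head w x A)))
risingOffsets-injective w (x ∷ A) (x′ ∷ A′) (_ ∷ A⁺) (_ ∷ A′⁺) same =
  cong₂ _∷_ x≡x′ (risingOffsets-injective (suc w) A A′ A⁺ A′⁺ same-tail)
  where
  x≡x′ : x ≡ x′
  x≡x′ = trans (sym (count-risingOffsets-head w x A)) (trans (same w ≤-refl) (count-risingOffsets-head w x′ A′))
  same-tail : ∀ v → suc w ≤ v → count v (risingOffsets (suc w) A) ≡ count v (risingOffsets (suc w) A′)
  same-tail v w<v = trans (sym (count-risingOffsets-tail x A w<v))
                          (trans (same v (<⇒≤ w<v)) (count-risingOffsets-tail x′ A′ w<v))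

fallingOffsets-head-injective : ∀ w x R x′ R′ → length R ≤ w → length R′ ≤ w →
  count w (fallingOffsets w (x ∷ R)) ≡ count w (fallingOffsets w (x′ ∷ R′)) → x ≡ x′
fallingOffsets-head-injective w x R x′ R′ |R|≤w |R′|≤w same =
  trans (sym (count-fallingOffsets-head w x R |R|≤w)) (trans same (count-fallingOffsets-head w x′ R′ |R′|≤w))

fallingOffsets-injective : ∀ t w B B′ → PositiveAfter t B → PositiveAfter t B′ →
  length B ≤ suc w → length B′ ≤ suc w →
  (∀ v → v ≤ w → count v (fallingOffsets w B) ≡ count v (fallingOffsets w B′)) → B ≡ B′
fallingOffsets-injective t w [] [] _ _ _ _ same = refl
fallingOffsets-injective zero w [] (x′ ∷ R′) _ (0<x′ ∷ _) _ (s≤s |R′|≤w) same =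
  ⊥-elim (<⇒≢ 0<x′ (trans (same w ≤-refl) (count-fallingOffsets-head w x′ R′ |R′|≤w)))
fallingOffsets-injective zero w (x ∷ R) [] (0<x ∷ _) _ (s≤s |R|≤w) _ same =
  ⊥-elim (<⇒≢ 0<x (trans (sym (same w ≤-refl)) (count-fallingOffsets-head w x R |R|≤w)))
fallingOffsets-injective t       zero    (x ∷ [])    (x′ ∷ [])     _ _ _ _ same =
  cong (_∷ []) (fallingOffsets-head-injective 0 x [] x′ [] z≤n z≤n (same 0 z≤n))
fallingOffsets-injective t       zero    (_ ∷ _ ∷ _) _             _ _ (s≤s ()) _ _
fallingOffsets-injective t       zero    (_ ∷ [])    (_ ∷ _ ∷ _)   _ _ _ (s≤s ()) _
fallingOffsets-injective t (suc w) (x ∷ R) (x′ ∷ R′) B⁺ B′⁺ (s≤s |R|≤w) (s≤s |R′|≤w) same =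
  cong₂ _∷_ (fallingOffsets-head-injective (suc w) x R x′ R′ |R|≤w |R′|≤w (same (suc w) ≤-refl))
            (fallingOffsets-injective (pred t) w R R′ (PositiveAfter-tail t B⁺) (PositiveAfter-tail t B′⁺)
                                      |R|≤w |R′|≤w same-tail)
  where
  same-tail : ∀ v → v ≤ w → count v (fallingOffsets w R) ≡ count v (fallingOffsets w R′)
  same-tail v v≤w = trans (sym (count-fallingOffsets-tail x R v≤w))
                          (trans (same v (m≤n⇒m≤1+n v≤w)) (count-fallingOffsets-tail x′ R′ v≤w))

count-offsets-low : ∀ {v} O B A → v ≤ O → count v (offsets O B A) ≡ count v (fallingOffsets O B)
count-offsets-low {v} O B A v≤O = trans (count-++ v (fallingOffsets O B) _)
  (trans (cong (count v (fallingOffsets O B) +_) (count-absent v _ v∉))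
         (+-identityʳ _))
  where
  v∉ : All (v ≢_) (risingOffsets (suc O) A)
  v∉ = All.map (λ O<u → <⇒≢ (≤-<-trans v≤O O<u)) (risingOffsets≥ (suc O) A)

count-offsets-high : ∀ {v} O B A → O < v → count v (offsets O B A) ≡ count v (risingOffsets (suc O) A)
count-offsets-high {v} O B A O<v = trans (count-++ v (fallingOffsets O B) _)
  (cong (_+ count v (risingOffsets (suc O) A)) (count-absent v _ v∉))
  where
  v∉ : All (v ≢_) (fallingOffsets O B)
  v∉ = All.map (λ u≤O → >⇒≢ (≤-<-trans u≤O O<v)) (fallingOffsets≤ O B)

offsets-injective : ∀ t O {B A B′ A′} → PositiveAfter t B → Positive A → PositiveAfter t B′ → Positive A′ →
  length B ≤ suc O → length B′ ≤ suc O →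
  (∀ v → count v (offsets O B A) ≡ count v (offsets O B′ A′)) → B ≡ B′ × A ≡ A′
offsets-injective t O {B} {A} {B′} {A′} B⁺ A⁺ B′⁺ A′⁺ |B|≤ |B′|≤ same =
  fallingOffsets-injective t O B B′ B⁺ B′⁺ |B|≤ |B′|≤ (λ v v≤O →
    trans (sym (count-offsets-low O B A v≤O)) (trans (same v) (count-offsets-low O B′ A′ v≤O))) ,
  risingOffsets-injective (suc O) A A′ A⁺ A′⁺ (λ v O<v →
    trans (sym (count-offsets-high O B A O<v)) (trans (same v) (count-offsets-high O B′ A′ O<v)))

-- The representation on power series

module PowerSeries {c ℓ : Level} (K : Field c ℓ) where
  private module K = Field K
  open K using (Carrier; _≈_; 0#; 1#) renaming (_+_ to _+ᴷ_; _*_ to _*ᴷ_; -_ to -ᴷ_)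
  open import Algebra.Properties.Ring K.ring using (-0#≈0#; -‿+-comm; -‿distribʳ-*; +-cancelˡ)
  open CommutativeSemigroupProperties K.+-commutativeSemigroup using (interchange)
  open AbelianGroupProperties K.+-abelianGroup using (//-rightDividesʳ)
  open CommutativeSemigroupProperties K.*-commutativeSemigroup using (x∙yz≈y∙xz)
  open Classes K

  ι : ℕ → Carrier
  ι = K ·1

  -- A sequence f stands for the power series Σᵢ f i · xⁱ; D acts as d/dx and U as
  -- multiplication by x.
  Series : Set c
  Series = ℕ → Carrier

  ⟦_⟧ : Tm → Series → Series
  ⟦ sc a ⟧  f i       = a *ᴷ f i
  ⟦ D ⟧     f i       = ι (suc i) *ᴷ f (suc i)
  ⟦ U ⟧     f zero    = 0#
  ⟦ U ⟧     f (suc i) = f i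
  ⟦ x ⊕ y ⟧ f i       = ⟦ x ⟧ f i +ᴷ ⟦ y ⟧ f i
  ⟦ ⊖ x ⟧   f i       = -ᴷ ⟦ x ⟧ f i
  ⟦ x ⊛ y ⟧ f i       = ⟦ x ⟧ (⟦ y ⟧ f) i

  ⟦⟧-cong : ∀ x {f g} → (∀ i → f i ≈ g i) → ∀ i → ⟦ x ⟧ f i ≈ ⟦ x ⟧ g i
  ⟦⟧-cong (sc a)  f≈g i       = K.*-congˡ (f≈g i)
  ⟦⟧-cong D       f≈g i       = K.*-congˡ (f≈g (suc i))
  ⟦⟧-cong U       f≈g zero    = K.refl
  ⟦⟧-cong U       f≈g (suc i) = f≈g i
  ⟦⟧-cong (x ⊕ y) f≈g i       = K.+-cong (⟦⟧-cong x f≈g i) (⟦⟧-cong y f≈g i)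
  ⟦⟧-cong (⊖ x)   f≈g i       = K.-‿cong (⟦⟧-cong x f≈g i)
  ⟦⟧-cong (x ⊛ y) f≈g i       = ⟦⟧-cong x (⟦⟧-cong y f≈g) i

  ⟦⟧-+ : ∀ x f g i → ⟦ x ⟧ (λ j → f j +ᴷ g j) i ≈ ⟦ x ⟧ f i +ᴷ ⟦ x ⟧ g i
  ⟦⟧-+ (sc a)  f g i       = K.distribˡ a (f i) (g i)
  ⟦⟧-+ D       f g i       = K.distribˡ _ (f (suc i)) (g (suc i))
  ⟦⟧-+ U       f g zero    = K.sym (K.+-identityʳ 0#)
  ⟦⟧-+ U       f g (suc i) = K.refl
  ⟦⟧-+ (x ⊕ y) f g i       = K.trans (K.+-cong (⟦⟧-+ x f g i) (⟦⟧-+ y f g i)) (interchange _ _ _ _)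
  ⟦⟧-+ (⊖ x)   f g i       = K.trans (K.-‿cong (⟦⟧-+ x f g i)) (K.sym (-‿+-comm _ _))
  ⟦⟧-+ (x ⊛ y) f g i       = K.trans (⟦⟧-cong x (⟦⟧-+ y f g) i) (⟦⟧-+ x (⟦ y ⟧ f) (⟦ y ⟧ g) i)

  ⟦⟧-* : ∀ x a f i → ⟦ x ⟧ (λ j → a *ᴷ f j) i ≈ a *ᴷ ⟦ x ⟧ f i
  ⟦⟧-* (sc b)  a f i       = x∙yz≈y∙xz b a (f i)
  ⟦⟧-* D       a f i       = x∙yz≈y∙xz _ a _
  ⟦⟧-* U       a f zero    = K.sym (K.zeroʳ a)
  ⟦⟧-* U       a f (suc i) = K.refl
  ⟦⟧-* (x ⊕ y) a f i       = K.trans (K.+-cong (⟦⟧-* x a f i) (⟦⟧-* y a f i)) (K.sym (K.distribˡ a _ _))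
  ⟦⟧-* (⊖ x)   a f i       = K.trans (K.-‿cong (⟦⟧-* x a f i)) (-‿distribʳ-* a _)
  ⟦⟧-* (x ⊛ y) a f i       = K.trans (⟦⟧-cong x (⟦⟧-* y a f) i) (⟦⟧-* x a (⟦ y ⟧ f) i)

  ⟦⟧-sound : ∀ {x y} → x ~ y → ∀ f i → ⟦ x ⟧ f i ≈ ⟦ y ⟧ f i
  ⟦⟧-sound ~refl                 f i = K.refl
  ⟦⟧-sound (~sym p)              f i = K.sym (⟦⟧-sound p f i)
  ⟦⟧-sound (~trans p q)          f i = K.trans (⟦⟧-sound p f i) (⟦⟧-sound q f i)
  ⟦⟧-sound (⊕-cong p q)          f i = K.+-cong (⟦⟧-sound p f i) (⟦⟧-sound q f i)
  ⟦⟧-sound (⊖-cong p)            f i = K.-‿cong (⟦⟧-sound p f i)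
  ⟦⟧-sound (⊛-cong {x} {_} {_} {y′} p q) f i = K.trans (⟦⟧-cong x (⟦⟧-sound q f) i) (⟦⟧-sound p (⟦ y′ ⟧ f) i)
  ⟦⟧-sound (⊕-assoc x y z)       f i = K.+-assoc _ _ _
  ⟦⟧-sound (⊕-comm x y)          f i = K.+-comm _ _
  ⟦⟧-sound (⊕-idʳ x)             f i = K.trans (K.+-congˡ (K.zeroˡ (f i))) (K.+-identityʳ _)
  ⟦⟧-sound (⊕-invʳ x)            f i = K.trans (K.-‿inverseʳ _) (K.sym (K.zeroˡ (f i)))
  ⟦⟧-sound (⊛-assoc x y z)       f i = K.refl
  ⟦⟧-sound (⊛-idˡ x)             f i = K.*-identityˡ _
  ⟦⟧-sound (⊛-idʳ x)             f i = ⟦⟧-cong x (λ j → K.*-identityˡ (f j)) i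
  ⟦⟧-sound (distribˡ x y z)      f i = ⟦⟧-+ x (⟦ y ⟧ f) (⟦ z ⟧ f) i
  ⟦⟧-sound (distribʳ x y z)      f i = K.refl
  ⟦⟧-sound (sc-cong p)           f i = K.*-congʳ p
  ⟦⟧-sound (sc-+ a b)            f i = K.distribʳ (f i) a b
  ⟦⟧-sound (sc-* a b)            f i = K.*-assoc a b (f i)
  ⟦⟧-sound (sc-central a x)      f i = K.sym (⟦⟧-* x a f i)
  ⟦⟧-sound weyl f zero    = K.trans (K.+-cong (K.*-congʳ (K.+-identityʳ 1#)) -0#≈0#) (K.+-identityʳ _)
  ⟦⟧-sound weyl f (suc i) = begin
    (1# +ᴷ n) *ᴷ x +ᴷ -ᴷ (n *ᴷ x)        ≈⟨ K.+-congʳ (K.distribʳ x 1# n) ⟩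
    (1# *ᴷ x +ᴷ n *ᴷ x) +ᴷ -ᴷ (n *ᴷ x)   ≈⟨ K.+-assoc _ _ _ ⟩
    1# *ᴷ x +ᴷ (n *ᴷ x +ᴷ -ᴷ (n *ᴷ x))   ≈⟨ K.+-congˡ (K.-‿inverseʳ _) ⟩
    1# *ᴷ x +ᴷ 0#                        ≈⟨ K.+-identityʳ _ ⟩
    1# *ᴷ x                              ∎
    where
    open SetoidReasoning K.setoid
    n = ι (suc i)
    x = f (suc i)

  ι-+ : ∀ m n → ι (m + n) ≈ ι m +ᴷ ι n
  ι-+ zero    n = K.sym (K.+-identityˡ _)
  ι-+ (suc m) n = K.trans (K.+-congˡ (ι-+ m n)) (K.sym (K.+-assoc _ _ _))

  ι-* : ∀ m n → ι (m * n) ≈ ι m *ᴷ ι n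
  ι-* zero    n = K.sym (K.zeroˡ _)
  ι-* (suc m) n = K.trans (ι-+ n (m * n))
    (K.trans (K.+-cong (K.sym (K.*-identityˡ _)) (ι-* m n)) (K.sym (K.distribʳ _ _ _)))

  open NormalForm K using (_⊛^_; θ+_; fallingΠ; risingΠ; θΠ; nf)

  record ActsAt (i : ℕ) (x : Tm) (α : Carrier) : Set (c Level.⊔ ℓ) where
    constructor actsAt
    field act : ∀ f → ⟦ x ⟧ f i ≈ α *ᴷ f i
  open ActsAt

  actsAt-cong : ∀ {i x α β} → α ≈ β → ActsAt i x α → ActsAt i x β
  actsAt-cong α≈β xα = actsAt λ f → K.trans (act xα f) (K.*-congʳ α≈β)

  actsAt-1 : ∀ {i} → ActsAt i (sc 1#) (ι 1)
  actsAt-1 = actsAt λ f → K.*-congʳ (K.sym (K.+-identityʳ 1#))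

  actsAt-⊛ : ∀ {i x y α β} → ActsAt i x α → ActsAt i y β → ActsAt i (x ⊛ y) (α *ᴷ β)
  actsAt-⊛ {y = y} xα yβ = actsAt λ f →
    K.trans (act xα (⟦ y ⟧ f)) (K.trans (K.*-congˡ (act yβ f)) (K.sym (K.*-assoc _ _ _)))

  -- θ = x d/dx is the Euler operator: it multiplies xⁱ by i.
  actsAt-θ+ : ∀ i a → ActsAt i (θ+ a) (ι i +ᴷ a)
  actsAt-θ+ zero    a = actsAt λ f → K.trans (K.+-identityˡ _) (K.*-congʳ (K.sym (K.+-identityˡ a)))
  actsAt-θ+ (suc i) a = actsAt λ f → K.sym (K.distribʳ (f (suc i)) (ι (suc i)) a)

  actsAt-++ : ∀ {i x y} M xs ys → ActsAt i x (ι (shiftedProduct M xs)) → ActsAt i y (ι (shiftedProduct M ys)) →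
              ActsAt i (x ⊛ y) (ι (shiftedProduct M (xs ++ ys)))
  actsAt-++ M xs ys xα yβ = actsAt-cong
    (K.trans (K.sym (ι-* (shiftedProduct M xs) _)) (K.reflexive (cong ι (sym (shiftedProduct-++ M xs ys))))) (actsAt-⊛ xα yβ)

  actsAt-⊛^ : ∀ {i x} M c n → ActsAt i x (ι (M + c)) → ActsAt i (x ⊛^ n) (ι (shiftedProduct M (replicate n c)))
  actsAt-⊛^ M c zero    xα = actsAt-1
  actsAt-⊛^ M c (suc n) xα = actsAt-cong (K.sym (ι-* (M + c) _)) (actsAt-⊛ xα (actsAt-⊛^ M c n xα))

  fallingΠ-actsAt : ∀ M O j B a → a ≈ -ᴷ ι j → j + length B ≤ suc O →
                    ActsAt (M + O) (fallingΠ a B) (ι (shiftedProduct M (fallingOffsets (O ∸ j) B)))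
  fallingΠ-actsAt M O j []      a a≈ _ = actsAt-1
  fallingΠ-actsAt M O j (x ∷ B) a a≈ j+|x∷B|≤ = actsAt-++ M (replicate x (O ∸ j)) _
    (actsAt-⊛^ M (O ∸ j) x (actsAt-cong eigenvalue (actsAt-θ+ (M + O) a)))
    (subst (λ w → ActsAt (M + O) (fallingΠ (a +ᴷ -ᴷ 1#) B) (ι (shiftedProduct M (fallingOffsets w B))))
      (sym (pred[m∸n]≡m∸[1+n] O j))
      (fallingΠ-actsAt M O (suc j) B (a +ᴷ -ᴷ 1#) next (subst (_≤ suc O) (+-suc j (length B)) j+|x∷B|≤)))
    where
    open SetoidReasoning K.setoid
    j≤O : j ≤ O
    j≤O = ≤-pred (≤-trans (s≤s (m≤m+n j (length B))) (subst (_≤ suc O) (+-suc j (length B)) j+|x∷B|≤))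
    M+O≡ : M + O ≡ M + (O ∸ j) + j
    M+O≡ = trans (cong (M +_) (sym (m∸n+n≡m j≤O))) (sym (+-assoc M (O ∸ j) j))
    eigenvalue : ι (M + O) +ᴷ a ≈ ι (M + (O ∸ j))
    eigenvalue = begin
      ι (M + O) +ᴷ a                   ≈⟨ K.+-congˡ a≈ ⟩
      ι (M + O) +ᴷ -ᴷ ι j              ≡⟨ cong (λ n → ι n +ᴷ -ᴷ ι j) M+O≡ ⟩
      ι (M + (O ∸ j) + j) +ᴷ -ᴷ ι j    ≈⟨ K.+-congʳ (ι-+ (M + (O ∸ j)) j) ⟩
      (ι (M + (O ∸ j)) +ᴷ ι j) +ᴷ -ᴷ ι j  ≈⟨ //-rightDividesʳ (ι j) _ ⟩
      ι (M + (O ∸ j))                  ∎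
    next : a +ᴷ -ᴷ 1# ≈ -ᴷ ι (suc j)
    next = K.trans (K.+-congʳ a≈) (K.trans (-‿+-comm (ι j) 1#) (K.-‿cong (K.+-comm (ι j) 1#)))

  risingΠ-actsAt : ∀ M O j A a → a ≈ ι j →
                   ActsAt (M + O) (risingΠ a A) (ι (shiftedProduct M (risingOffsets (j + O) A)))
  risingΠ-actsAt M O j []      a a≈ = actsAt-1
  risingΠ-actsAt M O j (x ∷ A) a a≈ = actsAt-++ M (replicate x (j + O)) _
    (actsAt-⊛^ M (j + O) x (actsAt-cong eigenvalue (actsAt-θ+ (M + O) a)))
    (risingΠ-actsAt M O (suc j) A (a +ᴷ 1#) (K.trans (K.+-congʳ a≈) (K.+-comm (ι j) 1#)))
    where
    open SetoidReasoning K.setoid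
    eigenvalue : ι (M + O) +ᴷ a ≈ ι (M + (j + O))
    eigenvalue = begin
      ι (M + O) +ᴷ a        ≈⟨ K.+-congˡ a≈ ⟩
      ι (M + O) +ᴷ ι j      ≈⟨ ι-+ (M + O) j ⟨
      ι (M + O + j)         ≡⟨ cong ι (trans (+-assoc M O j) (cong (M +_) (+-comm O j))) ⟩
      ι (M + (j + O))       ∎

  θΠ-actsAt : ∀ M O B A → length B ≤ suc O → ActsAt (M + O) (θΠ B A) (ι (shiftedProduct M (offsets O B A)))
  θΠ-actsAt M O B A |B|≤ = actsAt-++ M (fallingOffsets O B) _
    (fallingΠ-actsAt M O 0 B 0# (K.sym -0#≈0#) |B|≤) (risingΠ-actsAt M O 1 A 1# (K.sym (K.+-identityʳ 1#)))

  one : Series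
  one _ = 1#

  ⟦U⊛^⟧-one : ∀ t {i} → t ≤ i → ⟦ U ⊛^ t ⟧ one i ≈ 1#
  ⟦U⊛^⟧-one zero    _         = K.*-identityˡ 1#
  ⟦U⊛^⟧-one (suc t) (s≤s t≤i) = ⟦U⊛^⟧-one t t≤i

  nf-eval : ∀ t B A M O → t ≤ M + O → length B ≤ suc O →
            ⟦ nf (pos t , B , A) ⟧ one (M + O) ≈ ι (shiftedProduct M (offsets O B A))
  nf-eval t B A M O t≤ |B|≤ =
    K.trans (act (θΠ-actsAt M O B A |B|≤) _) (K.trans (K.*-congˡ (⟦U⊛^⟧-one t t≤)) (K.*-identityʳ _))

  module _ (char0 : CharZero K) where

    ι-injective-≤ : ∀ {m n} → m ≤ n → ι m ≈ ι n → m ≡ n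
    ι-injective-≤ {m} {n} m≤n ιm≈ιn = trans (sym (+-identityʳ m)) (trans (cong (m +_) (sym n∸m≡0)) (m+[n∸m]≡n m≤n))
      where
      open SetoidReasoning K.setoid
      n∸m≡0 : n ∸ m ≡ 0
      n∸m≡0 = char0 (n ∸ m) (+-cancelˡ (ι m) _ _ (begin
        ι m +ᴷ ι (n ∸ m)   ≈⟨ ι-+ m (n ∸ m) ⟨
        ι (m + (n ∸ m))    ≡⟨ cong ι (m+[n∸m]≡n m≤n) ⟩
        ι n                ≈⟨ ιm≈ιn ⟨
        ι m                ≈⟨ K.+-identityʳ (ι m) ⟨
        ι m +ᴷ 0#          ∎))

    ι-injective : ∀ {m n} → ι m ≈ ι n → m ≡ n
    ι-injective {m} {n} ιm≈ιn with ≤-total m n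
    ... | inj₁ m≤n = ι-injective-≤ m≤n ιm≈ιn
    ... | inj₂ n≤m = sym (ι-injective-≤ n≤m (K.sym ιm≈ιn))

    nf-injective : ∀ t {B A B′ A′} → PositiveAfter t B → Positive A → PositiveAfter t B′ → Positive A′ →
                   nf (pos t , B , A) ~ nf (pos t , B′ , A′) → B ≡ B′ × A ≡ A′
    nf-injective t {B} {A} {B′} {A′} B⁺ A⁺ B′⁺ A′⁺ nf≈nf′ =
      offsets-injective t O B⁺ A⁺ B′⁺ A′⁺ |B|≤ |B′|≤
        (shiftedProducts⇒count _ (offsets O B A) (offsets O B′ A′) ≤-refl same)
      where
      -- Taking O ≥ length B keeps the falling offsets O ∸ j free of truncation.
      O = t + (length B + length B′)
      |B|≤ : length B ≤ suc O
      |B|≤ = m≤n⇒m≤1+n (≤-trans (m≤m+n (length B) (length B′)) (m≤n+m _ t))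
      |B′|≤ : length B′ ≤ suc O
      |B′|≤ = m≤n⇒m≤1+n (≤-trans (m≤n+m (length B′) (length B)) (m≤n+m _ t))
      same : SameShiftedProducts (offsets O B A) (offsets O B′ A′)
      same M _ = ι-injective (K.trans (K.sym (nf-eval t B A M O t≤ |B|≤))
                             (K.trans (⟦⟧-sound nf≈nf′ one (M + O)) (nf-eval t B′ A′ M O t≤ |B′|≤)))
        where
        t≤ : t ≤ M + O
        t≤ = ≤-trans (m≤m+n t _) (m≤n+m O M)

-- Invariants of the normal form

#U : Word → ℕ
#U []       = 0
#U (Dₗ ∷ w) = #U w
#U (Uₗ ∷ w) = suc (#U w)

length≡#U+#D : ∀ w → length w ≡ #U w + #D w
length≡#U+#D []       = refl
length≡#U+#D (Dₗ ∷ w) = trans (cong suc (length≡#U+#D w)) (sym (+-suc (#U w) (#D w)))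
length≡#U+#D (Uₗ ∷ w) = cong suc (length≡#U+#D w)

Valid : State → Set
Valid (pos a , B , A)    = PositiveAfter a B × Positive A
Valid (-[1+ b ] , B , A) = Positive B × PositiveAfter (suc b) A

PositiveAfter-drop1 : ∀ t B → PositiveAfter (suc t) B → PositiveAfter t (drop 1 B)
PositiveAfter-drop1 t (_ ∷ _) B⁺ = B⁺

step-valid : ∀ x s → Valid s → Valid (step x s)
step-valid Uₗ (pos a , B , A)              (B⁺ , A⁺) = B⁺ , All.drop⁺ 1 A⁺
step-valid Uₗ (-[1+ zero ] , B , A)        (B⁺ , A⁺) = s≤s z≤n ∷ B⁺ , PositiveAfter-drop1 0 A A⁺
step-valid Uₗ (-[1+ suc b ] , B , A)       (B⁺ , A⁺) = s≤s z≤n ∷ B⁺ , PositiveAfter-drop1 (suc b) A A⁺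
step-valid Dₗ (pos zero , B , A)           (B⁺ , A⁺) = All.drop⁺ 1 B⁺ , A⁺
step-valid Dₗ (pos (suc a) , B , A)        (B⁺ , A⁺) = PositiveAfter-drop1 a B B⁺ , s≤s z≤n ∷ A⁺
step-valid Dₗ (-[1+ b ] , B , A)           (B⁺ , A⁺) = All.drop⁺ 1 B⁺ , A⁺

state-valid : ∀ w → Valid (state w)
state-valid []      = [] , []
state-valid (x ∷ w) = step-valid x (state w) (state-valid w)

weight : List ℕ × List ℕ → ℕ
weight (B , A) = sum B + sum A

sum-head₀ : ∀ L → sum L ≡ head₀ L + sum (drop 1 L)
sum-head₀ []      = refl
sum-head₀ (x ∷ L) = refl

weight-shiftU : ∀ x B A → weight ((x + head₀ A) ∷ B , drop 1 A) ≡ x + weight (B , A)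
weight-shiftU x B A =
  trans (solve 4 (λ x a s r → (x :+ a :+ s) :+ r := x :+ (s :+ (a :+ r))) refl x (head₀ A) (sum B) (sum (drop 1 A)))
        (cong (λ n → x + (sum B + n)) (sym (sum-head₀ A)))

weight-shiftD : ∀ x B A → weight (drop 1 B , (x + head₀ B) ∷ A) ≡ x + weight (B , A)
weight-shiftD x B A =
  trans (solve 4 (λ x b r a → r :+ (x :+ b :+ a) := x :+ ((b :+ r) :+ a)) refl x (head₀ B) (sum (drop 1 B)) (sum A))
        (cong (λ n → x + (n + sum A)) (sym (sum-head₀ B)))

Balanced : Word → State → Set
Balanced w (pos a , BA)    = #U w ≡ #D w + a × weight BA ≡ #D w
Balanced w (-[1+ b ] , BA) = #D w ≡ #U w + suc b × weight BA + suc b ≡ #D w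

step-balanced : ∀ x w s → Balanced w s → Balanced (x ∷ w) (step x s)
step-balanced Uₗ w (pos a , B , A) (U≡ , W≡) =
  trans (cong suc U≡) (sym (+-suc (#D w) a)) ,
  trans (weight-shiftU 0 B A) W≡
step-balanced Uₗ w (-[1+ zero ] , B , A) (D≡ , W≡) =
  trans (trans (+-comm 1 (#U w)) (sym D≡)) (sym (+-identityʳ (#D w))) ,
  trans (weight-shiftU 1 B A) (trans (+-comm 1 _) W≡)
step-balanced Uₗ w (-[1+ suc b ] , B , A) (D≡ , W≡) =
  trans D≡ (+-suc (#U w) (suc b)) ,
  trans (cong (_+ suc b) (weight-shiftU 1 B A)) (trans (sym (+-suc _ (suc b))) W≡)
step-balanced Dₗ w (pos zero , B , A) (U≡ , W≡) =
  trans (cong suc (trans (sym (+-identityʳ (#D w))) (sym U≡))) (+-comm 1 (#U w)) ,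
  trans (cong (_+ 1) (trans (weight-shiftD 0 B A) W≡)) (+-comm (#D w) 1)
step-balanced Dₗ w (pos (suc a) , B , A) (U≡ , W≡) =
  trans U≡ (+-suc (#D w) a) ,
  trans (weight-shiftD 1 B A) (cong suc W≡)
step-balanced Dₗ w (-[1+ b ] , B , A) (D≡ , W≡) =
  trans (cong suc D≡) (sym (+-suc (#U w) (suc b))) ,
  trans (cong (_+ suc (suc b)) (weight-shiftD 0 B A)) (trans (+-suc _ (suc b)) (cong suc W≡))

state-balanced : ∀ w → Balanced w (state w)
state-balanced []      = refl , refl
state-balanced (x ∷ w) = step-balanced x w (state w) (state-balanced w)

ValidState : ℕ → ℕ → List ℕ × List ℕ → Set
ValidState t k (B , A) = PositiveAfter t B × Positive A × weight (B , A) ≡ k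

state-shape : ∀ t k w → #U w ≡ t + k → #D w ≡ k →
              state w ≡ (pos t , proj₂ (state w)) × ValidState t k (proj₂ (state w))
state-shape t k w U≡ D≡ with state w | state-balanced w | state-valid w
... | pos a , B , A | U≡′ , W≡ | B⁺ , A⁺ =
  cong (λ a → pos a , B , A) a≡t , subst (λ a → PositiveAfter a B) a≡t B⁺ , A⁺ , trans W≡ D≡
  where
  a≡t : a ≡ t
  a≡t = +-cancelˡ-≡ k a t (trans (cong (_+ a) (sym D≡)) (trans (sym U≡′) (trans U≡ (+-comm t k))))
... | -[1+ b ] , B , A | D≡′ , _ | _ = ⊥-elim (m≢1+n+m k (trans (sym D≡) (trans D≡′ k+t+b)))
  where
  k+t+b : #U w + suc b ≡ suc (t + b + k)
  k+t+b = trans (cong (_+ suc b) U≡) (solve 3 (λ t k b → (t :+ k) :+ (con 1 :+ b) := con 1 :+ ((t :+ b) :+ k)) refl t k b)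

-- Canonical words

Ds : ℕ → Word
Ds n = replicate n Dₗ

zigzag : ℕ → Word
zigzag zero    = Uₗ ∷ []
zigzag (suc r) = Uₗ ∷ Dₗ ∷ zigzag r

zigzags : List ℕ → Word
zigzags = concatMap zigzag

step-D-nonpos : ∀ b B A → step Dₗ (ℤ.- pos b , B , A) ≡ (-[1+ b ] , drop 1 B , head₀ B ∷ A)
step-D-nonpos zero    B A = refl
step-D-nonpos (suc b) B A = refl

step-U-neg : ∀ b B c A → step Uₗ (-[1+ b ] , B , c ∷ A) ≡ (ℤ.- pos b , suc c ∷ B , A)
step-U-neg zero    B c A = refl
step-U-neg (suc b) B c A = refl

run-zigzag-nonneg : ∀ r a B A → run (zigzag r) (pos a , B , A) ≡ (pos (suc a) , (r + head₀ A) ∷ B , drop 1 A)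
run-zigzag-nonneg zero    a B A = refl
run-zigzag-nonneg (suc r) a B A rewrite run-zigzag-nonneg r a B A = refl

run-zigzag-neg : ∀ r b B c A → run (zigzag r) (-[1+ b ] , B , c ∷ A) ≡ (ℤ.- pos b , suc (r + c) ∷ B , A)
run-zigzag-neg zero    b B c A = step-U-neg b B c A
run-zigzag-neg (suc r) b B c A
  rewrite run-zigzag-neg r b B c A | step-D-nonpos b (suc (r + c) ∷ B) A = step-U-neg b B (suc (r + c)) A

run-Ds-descend : ∀ d → run (Ds d) (pos 0 , [] , []) ≡ (ℤ.- pos d , [] , replicate d 0)
run-Ds-descend zero    = refl
run-Ds-descend (suc d) rewrite run-Ds-descend d = step-D-nonpos d [] (replicate d 0)

replicate-∷ : ∀ n (x : ℕ) A → replicate n x ++ x ∷ A ≡ x ∷ replicate n x ++ A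
replicate-∷ zero    x A = refl
replicate-∷ (suc n) x A = cong (x ∷_) (replicate-∷ n x A)

run-zigzags-neg : ∀ P → Positive P → ∀ n B A →
  run (zigzags (map pred P)) (ℤ.- pos (length P + n) , B , replicate (length P) 0 ++ A) ≡ (ℤ.- pos n , P ++ B , A)
run-zigzags-neg []          _        n B A = refl
run-zigzags-neg (suc r ∷ P) (_ ∷ P⁺) n B A = begin
  run (zigzag r ++ zigzags (map pred P)) (-[1+ length P + n ] , B , 0 ∷ replicate (length P) 0 ++ A)
    ≡⟨ run-++ (zigzag r) (zigzags (map pred P)) _ ⟩
  run (zigzag r) (run (zigzags (map pred P)) (ℤ.- pos (suc (length P + n)) , B , 0 ∷ replicate (length P) 0 ++ A))
    ≡⟨ cong₂ (λ m L → run (zigzag r) (run (zigzags (map pred P)) (ℤ.- pos m , B , L)))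
             (sym (+-suc (length P) n)) (sym (replicate-∷ (length P) 0 A)) ⟩
  run (zigzag r) (run (zigzags (map pred P)) (ℤ.- pos (length P + suc n) , B , replicate (length P) 0 ++ 0 ∷ A))
    ≡⟨ cong (run (zigzag r)) (run-zigzags-neg P P⁺ (suc n) B (0 ∷ A)) ⟩
  run (zigzag r) (-[1+ n ] , P ++ B , 0 ∷ A)
    ≡⟨ run-zigzag-neg r n (P ++ B) 0 A ⟩
  (ℤ.- pos n , suc (r + 0) ∷ P ++ B , A)
    ≡⟨ cong (λ m → ℤ.- pos n , suc m ∷ P ++ B , A) (+-identityʳ r) ⟩
  (ℤ.- pos n , suc r ∷ P ++ B , A) ∎
  where open ≡-Reasoning

run-zigzags-nonneg : ∀ R a B → run (zigzags R) (pos a , B , []) ≡ (pos (length R + a) , R ++ B , [])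
run-zigzags-nonneg []      a B = refl
run-zigzags-nonneg (r ∷ R) a B
  rewrite run-++ (zigzag r) (zigzags R) (pos a , B , []) | run-zigzags-nonneg R a B
        | run-zigzag-nonneg r (length R + a) (R ++ B) [] | +-identityʳ r = refl

run-Ds-nonneg : ∀ Q → Positive Q → ∀ t B →
  run (Ds (length Q)) (pos (length Q + t) , reverse (map pred Q) ++ B , []) ≡ (pos t , B , Q)
run-Ds-nonneg []          _        t B = refl
run-Ds-nonneg (suc q ∷ Q) (_ ∷ Q⁺) t B = cong (step Dₗ) (begin
  run (Ds (length Q)) (pos (suc (length Q + t)) , reverse (q ∷ map pred Q) ++ B , [])
    ≡⟨ cong₂ (λ m L → run (Ds (length Q)) (pos m , L , [])) (sym (+-suc (length Q) t))
             (trans (cong (_++ B) (unfold-reverse q (map pred Q))) (++-assoc (reverse (map pred Q)) (q ∷ []) B)) ⟩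
  run (Ds (length Q)) (pos (length Q + suc t) , reverse (map pred Q) ++ q ∷ B , [])
    ≡⟨ run-Ds-nonneg Q Q⁺ (suc t) (q ∷ B) ⟩
  (pos (suc t) , q ∷ B , Q) ∎)
  where open ≡-Reasoning

length-take : ∀ t B → PositiveAfter t B → length (take t B) ≡ t
length-take zero    B       _  = refl
length-take (suc t) (x ∷ B) B⁺ = cong suc (length-take t B B⁺)

drop-positive : ∀ t B → PositiveAfter t B → Positive (drop t B)
drop-positive zero    B       B⁺ = B⁺
drop-positive (suc t) (x ∷ B) B⁺ = drop-positive t B B⁺

-- Read from the right: with P = drop t B, descend to depth |P|, climb back to height 0
-- laying down P, climb to height |A| + t laying down the first t entries of B and the
-- entries of A (lowered by one), and finally descend by |A|, which moves those onto A.
canonical : ℕ → List ℕ × List ℕ → Word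
canonical t (B , A) =
  Ds (length A) ++ zigzags (reverse (map pred A) ++ take t B) ++ zigzags (map pred (drop t B)) ++ Ds (length (drop t B))

state-canonical : ∀ t B A → PositiveAfter t B → Positive A → state (canonical t (B , A)) ≡ (pos t , B , A)
state-canonical t B A B⁺ A⁺ = begin
  state (canonical t (B , A))
    ≡⟨ run-++ (Ds (length A)) _ _ ⟩
  run (Ds (length A)) (run (zigzags R ++ zigzags (map pred P) ++ Ds (length P)) (pos 0 , [] , []))
    ≡⟨ cong (run (Ds (length A))) (run-++ (zigzags R) _ _) ⟩
  run (Ds (length A)) (run (zigzags R) (run (zigzags (map pred P) ++ Ds (length P)) (pos 0 , [] , [])))
    ≡⟨ cong (λ s → run (Ds (length A)) (run (zigzags R) s)) (run-++ (zigzags (map pred P)) _ _) ⟩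
  run (Ds (length A)) (run (zigzags R) (run (zigzags (map pred P)) (run (Ds (length P)) (pos 0 , [] , []))))
    ≡⟨ cong (λ s → run (Ds (length A)) (run (zigzags R) (run (zigzags (map pred P)) s))) (run-Ds-descend (length P)) ⟩
  run (Ds (length A)) (run (zigzags R) (run (zigzags (map pred P)) (ℤ.- pos (length P) , [] , replicate (length P) 0)))
    ≡⟨ cong (λ s → run (Ds (length A)) (run (zigzags R) s)) ascend ⟩
  run (Ds (length A)) (run (zigzags R) (pos 0 , P , []))
    ≡⟨ cong (run (Ds (length A))) (run-zigzags-nonneg R 0 P) ⟩
  run (Ds (length A)) (pos (length R + 0) , R ++ P , [])
    ≡⟨ cong₂ (λ h L → run (Ds (length A)) (pos h , L , [])) |R|+0 (++-assoc (reverse (map pred A)) (take t B) P) ⟩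
  run (Ds (length A)) (pos (length A + t) , reverse (map pred A) ++ take t B ++ P , [])
    ≡⟨ run-Ds-nonneg A A⁺ t _ ⟩
  (pos t , take t B ++ drop t B , A)
    ≡⟨ cong (λ B′ → pos t , B′ , A) (take++drop≡id t B) ⟩
  (pos t , B , A) ∎
  where
  open ≡-Reasoning
  P = drop t B
  R = reverse (map pred A) ++ take t B
  ascend : run (zigzags (map pred P)) (ℤ.- pos (length P) , [] , replicate (length P) 0) ≡ (pos 0 , P , [])
  ascend = trans (cong₂ (λ m L → run (zigzags (map pred P)) (ℤ.- pos m , [] , L))
                        (sym (+-identityʳ (length P))) (sym (++-identityʳ (replicate (length P) 0))))
                 (trans (run-zigzags-neg P (drop-positive t B B⁺) 0 [] []) (cong (λ L → pos 0 , L , []) (++-identityʳ P)))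
  |R|+0 : length R + 0 ≡ length A + t
  |R|+0 = trans (+-identityʳ _) (trans (length-++ (reverse (map pred A)))
            (cong₂ _+_ (trans (length-reverse (map pred A)) (length-map pred A)) (length-take t B B⁺)))

bumpHead : List ℕ → List ℕ
bumpHead []      = []
bumpHead (x ∷ L) = suc x ∷ L

bumpHead-injective : ∀ {L L′} → bumpHead L ≡ bumpHead L′ → L ≡ L′
bumpHead-injective {[]}    {[]}     _    = refl
bumpHead-injective {_ ∷ _} {_ ∷ _} refl = refl

-- The compositions of suc k (not of k).
compositions⁺ : ℕ → List (List ℕ)
compositions⁺ zero    = (1 ∷ []) ∷ []
compositions⁺ (suc k) = map (1 ∷_) (compositions⁺ k) ++ map bumpHead (compositions⁺ k)

-- Split by whether θ occurs, i.e. whether B starts with 0; this split is the recurrence.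
validStates : ℕ → ℕ → List (List ℕ × List ℕ)
validStates zero    zero    = ([] , []) ∷ []
validStates zero    (suc k) = map ([] ,_) (compositions⁺ k) ++ map (map₁ bumpHead) (validStates 1 k)
validStates (suc t) zero    = map (map₁ (0 ∷_)) (validStates t zero)
validStates (suc t) (suc k) =
  map (map₁ (0 ∷_)) (validStates t (suc k)) ++ map (map₁ bumpHead) (validStates (suc t) k)

length-validStates : ∀ t k →
  length (validStates (suc t) (suc k)) ≡ length (validStates t (suc k)) + length (validStates (suc t) k)
length-validStates t k = trans (length-++ (map (map₁ (0 ∷_)) (validStates t (suc k))))
  (cong₂ _+_ (length-map (map₁ (0 ∷_)) (validStates t (suc k))) (length-map (map₁ bumpHead) (validStates (suc t) k)))

Composition : ℕ → List ℕ → Set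
Composition k C = Positive C × sum C ≡ k

compositions⁺-sound : ∀ k → All (Composition (suc k)) (compositions⁺ k)
compositions⁺-sound zero    = (s≤s z≤n ∷ [] , refl) ∷ []
compositions⁺-sound (suc k) = All.++⁺
  (All.map⁺ (All.map (λ (C⁺ , ΣC) → s≤s z≤n ∷ C⁺ , cong suc ΣC) (compositions⁺-sound k)))
  (All.map⁺ (All.map bump (compositions⁺-sound k)))
  where
  bump : ∀ {C} → Composition (suc k) C → Composition (suc (suc k)) (bumpHead C)
  bump {_ ∷ _} (_ ∷ C⁺ , ΣC) = s≤s z≤n ∷ C⁺ , cong suc ΣC

bump-validˡ : ∀ {k s} → ValidState 1 k s → ValidState 0 (suc k) (map₁ bumpHead s)
bump-validˡ {s = _ ∷ P , A} (P⁺ , A⁺ , w) = (s≤s z≤n ∷ P⁺) , A⁺ , cong suc w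

bump-validʳ : ∀ {t k s} → ValidState (suc t) k s → ValidState (suc t) (suc k) (map₁ bumpHead s)
bump-validʳ {s = _ ∷ B , A} (B⁺ , A⁺ , w) = B⁺ , A⁺ , cong suc w

validStates-sound : ∀ t k → All (ValidState t k) (validStates t k)
validStates-sound zero    zero    = ([] , [] , refl) ∷ []
validStates-sound zero    (suc k) = All.++⁺
  (All.map⁺ (All.map (λ (A⁺ , ΣA) → [] , A⁺ , ΣA) (compositions⁺-sound k)))
  (All.map⁺ (All.map (λ {s} → bump-validˡ {s = s}) (validStates-sound 1 k)))
validStates-sound (suc t) zero    = All.map⁺ (validStates-sound t zero)
validStates-sound (suc t) (suc k) = All.++⁺
  (All.map⁺ (validStates-sound t (suc k)))
  (All.map⁺ (All.map (λ {s} → bump-validʳ {s = s}) (validStates-sound (suc t) k)))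

compositions⁺-complete : ∀ k C → Composition (suc k) C → C ∈ compositions⁺ k
compositions⁺-complete k       (0 ∷ _)           (() ∷ _ , _)
compositions⁺-complete zero    (1 ∷ [])          _               = here refl
compositions⁺-complete zero    (1 ∷ 0 ∷ _)       (_ ∷ () ∷ _ , _)
compositions⁺-complete zero    (1 ∷ suc _ ∷ _)   (_ , ())
compositions⁺-complete zero    (suc (suc _) ∷ _) (_ , ())
compositions⁺-complete (suc k) (1 ∷ C)           (_ ∷ C⁺ , ΣC)   =
  ∈-++⁺ˡ (∈-map⁺ (1 ∷_) (compositions⁺-complete k C (C⁺ , suc-injective ΣC)))
compositions⁺-complete (suc k) (suc (suc x) ∷ C) (_ ∷ C⁺ , ΣC)   =
  ∈-++⁺ʳ _ (∈-map⁺ bumpHead (compositions⁺-complete k (suc x ∷ C) (s≤s z≤n ∷ C⁺ , suc-injective ΣC)))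

validStates-complete : ∀ t k B A → ValidState t k (B , A) → (B , A) ∈ validStates t k
validStates-complete zero zero [] [] _ = here refl
validStates-complete zero zero [] (0 ∷ _) (_ , () ∷ _ , _)
validStates-complete zero zero [] (suc _ ∷ _) (_ , _ , ())
validStates-complete zero zero (suc _ ∷ _) A (_ , _ , ())
validStates-complete zero (suc k) [] A (_ , A⁺ , w) =
  ∈-++⁺ˡ (∈-map⁺ ([] ,_) (compositions⁺-complete k A (A⁺ , w)))
validStates-complete zero (suc k) (suc p ∷ P) A (_ ∷ P⁺ , A⁺ , w) =
  ∈-++⁺ʳ _ (∈-map⁺ (map₁ bumpHead) (validStates-complete 1 k (p ∷ P) A (P⁺ , A⁺ , suc-injective w)))
validStates-complete zero k (0 ∷ _) A ((() ∷ _) , _)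
validStates-complete (suc t) zero (0 ∷ B) A (B⁺ , A⁺ , w) =
  ∈-map⁺ (map₁ (0 ∷_)) (validStates-complete t zero B A (B⁺ , A⁺ , w))
validStates-complete (suc t) zero (suc _ ∷ B) A (_ , _ , ())
validStates-complete (suc t) (suc k) (0 ∷ B) A (B⁺ , A⁺ , w) =
  ∈-++⁺ˡ (∈-map⁺ (map₁ (0 ∷_)) (validStates-complete t (suc k) B A (B⁺ , A⁺ , w)))
validStates-complete (suc t) (suc k) (suc z ∷ B) A (B⁺ , A⁺ , w) =
  ∈-++⁺ʳ _ (∈-map⁺ (map₁ bumpHead) (validStates-complete (suc t) k (z ∷ B) A (B⁺ , A⁺ , suc-injective w)))
validStates-complete (suc t) k [] A (() , _)

map-disjoint : ∀ {X Y Z : Set} {f : X → Z} {g : Y → Z} {xs ys} →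
               (∀ {x y} → x ∈ xs → y ∈ ys → f x ≢ g y) → Disjoint (map f xs) (map g ys)
map-disjoint {f = f} {g} f≢g (v∈fxs , v∈gys) with ∈-map⁻ f v∈fxs | ∈-map⁻ g v∈gys
... | _ , x∈xs , v≡fx | _ , y∈ys , v≡gy = f≢g x∈xs y∈ys (trans (sym v≡fx) v≡gy)

map₁-injective : ∀ {f : List ℕ → List ℕ} → (∀ {L L′} → f L ≡ f L′ → L ≡ L′) →
                 ∀ {s s′ : List ℕ × List ℕ} → map₁ f s ≡ map₁ f s′ → s ≡ s′
map₁-injective f-injective eq = cong₂ _,_ (f-injective (cong proj₁ eq)) (cong proj₂ eq)

compositions⁺-unique : ∀ k → Unique (compositions⁺ k)
compositions⁺-unique zero    = [] AllPairs.∷ AllPairs.[]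
compositions⁺-unique (suc k) = Unique.++⁺
  (Unique.map⁺ ∷-injectiveʳ (compositions⁺-unique k))
  (Unique.map⁺ bumpHead-injective (compositions⁺-unique k))
  (map-disjoint λ _ C′∈ → 1∷≢bumpHead (All.lookup (compositions⁺-sound k) C′∈))
  where
  1∷≢bumpHead : ∀ {C C′} → Composition (suc k) C′ → 1 ∷ C ≢ bumpHead C′
  1∷≢bumpHead {C′ = _ ∷ _} (0<x ∷ _ , _) eq = <⇒≢ 0<x (suc-injective (∷-injectiveˡ eq))

validStates-unique : ∀ t k → Unique (validStates t k)
validStates-unique zero    zero    = [] AllPairs.∷ AllPairs.[]
validStates-unique zero    (suc k) = Unique.++⁺
  (Unique.map⁺ (cong proj₂) (compositions⁺-unique k))
  (Unique.map⁺ (map₁-injective bumpHead-injective) (validStates-unique 1 k))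
  (map-disjoint λ _ s′∈ → []≢bumpHead (All.lookup (validStates-sound 1 k) s′∈))
  where
  []≢bumpHead : ∀ {A s′} → ValidState 1 k s′ → ([] , A) ≢ map₁ bumpHead s′
  []≢bumpHead {s′ = _ ∷ _ , _} _ ()
validStates-unique (suc t) zero    = Unique.map⁺ (map₁-injective ∷-injectiveʳ) (validStates-unique t zero)
validStates-unique (suc t) (suc k) = Unique.++⁺
  (Unique.map⁺ (map₁-injective ∷-injectiveʳ) (validStates-unique t (suc k)))
  (Unique.map⁺ (map₁-injective bumpHead-injective) (validStates-unique (suc t) k))
  (map-disjoint λ _ s′∈ → 0∷≢bumpHead (All.lookup (validStates-sound (suc t) k) s′∈))
  where
  0∷≢bumpHead : ∀ {s s′} → ValidState (suc t) k s′ → map₁ (0 ∷_) s ≢ map₁ bumpHead s′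
  0∷≢bumpHead {s′ = _ ∷ _ , _} _ ()

-- Counting the classes

index-∈-lookup : ∀ {X : Set} (L : List X) i → Any.index (∈-lookup {xs = L} i) ≡ i
index-∈-lookup (x ∷ L) Fin.zero    = refl
index-∈-lookup (x ∷ L) (Fin.suc i) = cong Fin.suc (index-∈-lookup L i)

index-unique : ∀ {X : Set} {L : List X} {x y} → Unique L →
               (p : x ∈ L) (q : y ∈ L) → x ≡ y → Any.index p ≡ Any.index q
index-unique _               (here refl) (here refl) _    = refl
index-unique (x∉L AllPairs.∷ _) (here refl) (there q)   refl = ⊥-elim (All.lookup x∉L q refl)
index-unique (x∉L AllPairs.∷ _) (there p)   (here refl) refl = ⊥-elim (All.lookup x∉L p refl)
index-unique (_ AllPairs.∷ L!)  (there p)   (there q)   x≡y  = cong Fin.suc (index-unique L! p q x≡y)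

module Counting {c ℓ : Level} (K : Field c ℓ) where
  open Classes K

  numClasses-from-invariant : ∀ {n k} {X : Set} (L : List X) (inv : Words n k → X) → Unique L →
    (∀ x → inv x ∈ L) → (∀ {z} → z ∈ L → Σ (Words n k) λ x → inv x ≡ z) →
    (∀ x y → proj₁ x ≡W proj₁ y → inv x ≡ inv y) → (∀ x y → inv x ≡ inv y → proj₁ x ≡W proj₁ y) →
    NumClasses n k (length L)
  numClasses-from-invariant L inv L! inv∈L realise ≡W⇒≡ ≡⇒≡W = f , surjective , λ x y → to x y , from x y
    where
    f : _ → _
    f x = Any.index (inv∈L x)
    surjective : ∀ i → Σ _ λ x → ∀ {z} → z ≡ x → f z ≡ i
    surjective i = proj₁ (realise (∈-lookup i)) , λ { refl →
      trans (index-unique L! (inv∈L _) (∈-lookup i) (proj₂ (realise (∈-lookup i)))) (index-∈-lookup L i) }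
    to : ∀ x y → proj₁ x ≡W proj₁ y → f x ≡ f y
    to x y x≡Wy = index-unique L! (inv∈L x) (inv∈L y) (≡W⇒≡ x y x≡Wy)
    from : ∀ x y → f x ≡ f y → proj₁ x ≡W proj₁ y
    from x y fx≡fy =
      ≡⇒≡W x y (trans (lookup-index (inv∈L x)) (trans (cong (lookup L) fx≡fy) (sym (lookup-index (inv∈L y)))))

module _ {c ℓ : Level} (K : Field c ℓ) (char0 : CharZero K) where
  open Classes K
  open NormalForm K using (Tm-setoid; nf; φ~nf; state≡⇒≡W)
  open PowerSeries K using (nf-injective)
  open Counting K using (numClasses-from-invariant)

  numClasses-validStates : ∀ t k → NumClasses (t + k + k) k (length (validStates t k))
  numClasses-validStates t k =
    numClasses-from-invariant (validStates t k) inv (validStates-unique t k) inv∈ realise ≡W⇒≡ ≡⇒≡W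
    where
    inv : Words (t + k + k) k → List ℕ × List ℕ
    inv x = proj₂ (state (proj₁ x))

    shape : ∀ x → state (proj₁ x) ≡ (pos t , inv x) × ValidState t k (inv x)
    shape (w , |w| , #D≡k) = state-shape t k w #U≡ #D≡k
      where
      #U≡ : #U w ≡ t + k
      #U≡ = +-cancelʳ-≡ k _ _ (trans (cong (#U w +_) (sym #D≡k)) (trans (sym (length≡#U+#D w)) |w|))

    inv∈ : ∀ x → inv x ∈ validStates t k
    inv∈ x = validStates-complete t k _ _ (proj₂ (shape x))

    realise : ∀ {z} → z ∈ validStates t k → Σ (Words (t + k + k) k) λ x → inv x ≡ z
    realise {B , A} z∈ = (w , |w| , #D≡k) , cong proj₂ w↦z
      where
      valid = All.lookup (validStates-sound t k) z∈
      w = canonical t (B , A)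
      w↦z = state-canonical t B A (proj₁ valid) (proj₁ (proj₂ valid))
      counts : #U w ≡ #D w + t × weight (B , A) ≡ #D w
      counts = subst (Balanced w) w↦z (state-balanced w)
      #D≡k : #D w ≡ k
      #D≡k = trans (sym (proj₂ counts)) (proj₂ (proj₂ valid))
      |w| : length w ≡ t + k + k
      |w| = trans (length≡#U+#D w)
        (trans (cong₂ _+_ (trans (proj₁ counts) (cong (_+ t) #D≡k)) #D≡k) (cong (_+ k) (+-comm k t)))

    ≡W⇒≡ : ∀ x y → proj₁ x ≡W proj₁ y → inv x ≡ inv y
    ≡W⇒≡ x y x≡Wy = cong₂ _,_ (proj₁ B,A≡) (proj₂ B,A≡)
      where
      valid = proj₂ (shape x)
      valid′ = proj₂ (shape y)
      B,A≡ = nf-injective char0 t (proj₁ valid) (proj₁ (proj₂ valid)) (proj₁ valid′) (proj₁ (proj₂ valid′)) (begin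
        nf (pos t , inv x)       ≡⟨ cong nf (proj₁ (shape x)) ⟨
        nf (state (proj₁ x))     ≈⟨ φ~nf (proj₁ x) ⟨
        φ (proj₁ x)              ≈⟨ x≡Wy ⟩
        φ (proj₁ y)              ≈⟨ φ~nf (proj₁ y) ⟩
        nf (state (proj₁ y))     ≡⟨ cong nf (proj₁ (shape y)) ⟩
        nf (pos t , inv y)       ∎)
        where open SetoidReasoning Tm-setoid

    ≡⇒≡W : ∀ x y → inv x ≡ inv y → proj₁ x ≡W proj₁ y
    ≡⇒≡W x y inv≡ = state≡⇒≡W (proj₁ x) (proj₁ y)
      (trans (proj₁ (shape x)) (trans (cong (pos t ,_) inv≡) (sym (proj₁ (shape y)))))

  recurrence : ∀ t k → Σ ℕ λ a → Σ ℕ λ b → Σ ℕ λ d →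
    NumClasses (suc t + k + k) k a × NumClasses (suc t + k + k ∸ 1) k b ×
    NumClassesPred (suc t + k + k) k d × a ≡ b + d
  recurrence t zero =
    _ , _ , 0 , numClasses-validStates (suc t) 0 , numClasses-validStates t 0 , lift refl ,
    trans (length-map (map₁ (0 ∷_)) (validStates t 0)) (sym (+-identityʳ _))
  recurrence t (suc k) =
    _ , _ , _ , numClasses-validStates (suc t) (suc k) , numClasses-validStates t (suc k) ,
    subst (λ n → NumClasses n k (length (validStates (suc t) k))) n∸2 (numClasses-validStates (suc t) k) ,
    length-validStates t k
    where
    n∸2 : suc t + k + k ≡ suc t + suc k + suc k ∸ 2
    n∸2 = cong pred (sym (trans (+-suc (t + suc k) k) (cong (λ m → suc (m + k)) (+-suc t k))))

2k<n⇒n≡1+t+k+k : ∀ n k → 2 * k < n → Σ ℕ λ t → n ≡ suc t + k + k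
2k<n⇒n≡1+t+k+k n k 2k<n = n ∸ suc (k + k) , sym (begin
  suc (n ∸ suc (k + k) + k + k)     ≡⟨ cong suc (+-assoc (n ∸ suc (k + k)) k k) ⟩
  suc (n ∸ suc (k + k) + (k + k))   ≡⟨ +-suc (n ∸ suc (k + k)) (k + k) ⟨
  n ∸ suc (k + k) + suc (k + k)     ≡⟨ m∸n+n≡m (subst (λ m → suc (k + m) ≤ n) (+-identityʳ k) 2k<n) ⟩
  n                                 ∎)
  where open ≡-Reasoning

lemma6p2 : ∀ {c ℓ : Level} (K : Field c ℓ) → CharZero K →
    ∀ (n k : ℕ) → 2 * k < n →
    Σ ℕ λ a → Σ ℕ λ b → Σ ℕ λ d →
    Classes.NumClasses K n k a ×
    Classes.NumClasses K (n ∸ 1) k b ×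
    Classes.NumClassesPred K n k d ×
    a ≡ b + d
lemma6p2 K char0 n k 2k<n with 2k<n⇒n≡1+t+k+k n k 2k<n
... | t , refl = recurrence K char0 t k
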